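{- Let $F=\mathbb{F}_q$, $q=2^r$, and let $(F,+,\circ)$ be a symplectic presemifield, with multiplication written uniquely as $x\circ y=\sum_{i,j=0}^{r-1}a_{ij}x^{2^i}y^{2^j}$ ($a_{ij}\in F$). Then: (1) ${\rm tr}(x\cdot(z\circ y))={\rm tr}(z\cdot(x\circ y))$ for all $x,y,z\in F$; (2) ${\rm Tr}(\hat x\cdot(\hat z\circ\hat y))={\rm Tr}(\hat z\cdot(\hat x\circ\hat y))$ for all $x,y,z\in F$.
   Context: ${\rm tr}:\mathbb{F}_q\to\mathbb{F}_2$ is the absolute trace. A presemifield $(F,+,\circ)$ is the additive group of $F$ with a multiplication $\circ$ that is left and right distributive over $+$ and has no zero divisors; it is symplectic if each subspace $\{(0,y)\mid y\in F\}$ and $\{(x,x\circ y)\mid x\in F\}$ ($y\in F$) of $F\oplus F$ is totally isotropic for the alternating form $\langle(u,v),(u',v')\rangle={\rm tr}(uv'-vu')$. Let $R=GR(4^r)$ be the Galois ring of characteristic $4$ and cardinality $4^r$, so $R/2R\cong\mathbb{F}_q$; let $\mathcal{T}=\{0\}\cup C\subset R$ be the Teichmüller set, where $C$ is the cyclic subgroup of order $2^r-1$ of the unit group of $R$. Each $u\in F$ has a unique Teichmüller lift $\hat u\in\mathcal{T}$ reducing to $u$ mod $2R$. Every $x\in R$ is uniquely $x=a+2b$ with $a,b\in\mathcal{T}$, and ${\rm Tr}(x)=\sum_{i=0}^{r-1}(a^{2^i}+2b^{2^i})\in\mathbb{Z}_4\subseteq R$. The operation $\circ$ is extended to $\mathcal{T}\times\mathcal{T}$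 by $\hat x\circ\hat y=\sum_{i,j=0}^{r-1}\widehat{a_{ij}}\,\hat x^{2^i}\hat y^{2^j}\in R$. -}

module Defs where

open import Data.Nat using (ℕ; zero; suc; _^_; _∸_)
open import Data.Fin using (Fin)
import Data.Fin as Fin
import Data.Fin.Properties as FinP
open import Data.List using (List; []; _∷_; map; allFin)
open import Data.Sum using (_⊎_)
open import Data.Product using (_×_; ∃)
import Data.Product
open import Relation.Nullary using (¬_; Dec; yes; no)
open import Relation.Unary using (Pred; Decidable)
open import Relation.Binary.PropositionalEquality
  using (_≡_; _≢_; refl; sym; trans; cong)
open import Relation.Binary.Definitions using (DecidableEquality)
open import Algebra.Structures using (IsCommutativeRing)
open import Function.Bundles using (_↔_; Inverse)
open import Data.Sum using (inj₁; inj₂)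

record CRing : Set₁ where
  infixl 7 _*_
  infixl 6 _+_ _-_
  infix  8 -_
  field
    Carrier : Set
    _+_ _*_ : Carrier → Carrier → Carrier
    -_      : Carrier → Carrier
    0# 1#   : Carrier
    isCommutativeRing : IsCommutativeRing _≡_ _+_ _*_ -_ 0# 1#

  _-_ : Carrier → Carrier → Carrier
  x - y = x + (- y)

  two : Carrier
  two = 1# + 1#

  pow : Carrier → ℕ → Carrier
  pow x zero    = 1#
  pow x (suc n) = x * pow x n

  sumFin : ∀ n → (Fin n → Carrier) → Carrier
  sumFin zero    f = 0#
  sumFin (suc n) f = f Fin.zero + sumFin n (λ i → f (Fin.suc i))

module Enum {A : Set} {n : ℕ} (e : Fin n ↔ A) where
  open Inverse e

  _≟_ : DecidableEquality A
  x ≟ y with from x FinP.≟ from y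
  ... | yes p = yes (trans (sym (inverseˡ refl)) (trans (cong to p) (inverseˡ refl)))
  ... | no ¬p = no (λ eq → ¬p (cong from eq))

  elems : List A
  elems = map to (allFin n)

firstOr : {A : Set} {P : Pred A Agda.Primitive.lzero} → Decidable P → A → List A → A
firstOr P? d []       = d
firstOr P? d (x ∷ xs) with P? x
... | yes _ = x
... | no  _ = firstOr P? d xs

record FiniteField (r : ℕ) : Set₁ where
  field
    ring       : CRing
  open CRing ring public
  field
    nontrivial : 1# ≢ 0#
    inverse    : ∀ x → x ≢ 0# → ∃ λ y → x * y ≡ 1#
    card       : Fin (2 ^ r) ↔ Carrier

  tr : Carrier → Carrier
  tr u = sumFin r (λ i → pow u (2 ^ Fin.toℕ i))

-- The Galois ring R = GR(4^r) with residue field F: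
-- a commutative ring of characteristic 4 with 4^r elements, with a surjective
-- ring homomorphism π : R → F whose kernel is 2R, and which is local
-- (every element outside 2R is a unit), i.e. 2R is its unique maximal ideal.

record GaloisRing4 (r : ℕ) (F : FiniteField r) : Set₁ where
  module F = FiniteField F
  field
    ring   : CRing
  open CRing ring public
  field
    card   : Fin (4 ^ r) ↔ Carrier
    char4  : two + two ≡ 0#
    two≢0  : two ≢ 0#
    π      : Carrier → F.Carrier
    π-+    : ∀ x y → π (x + y) ≡ F._+_ (π x) (π y)
    π-*    : ∀ x y → π (x * y) ≡ F._*_ (π x) (π y)
    π-1    : π 1# ≡ F.1#
    π-surj : ∀ u → ∃ λ x → π x ≡ u
    π-ker  : ∀ x → π x ≡ F.0# → ∃ λ y → x ≡ two * y
    ker-π  : ∀ y → π (two * y) ≡ F.0#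
    local  : ∀ x → π x ≢ F.0# → ∃ λ y → x * y ≡ 1#

  open Enum card using (_≟_; elems)
  private
    _≟F_ = Enum._≟_ F.card

  IsTeich : Carrier → Set
  IsTeich t = t ≡ 0# ⊎ pow t (2 ^ r ∸ 1) ≡ 1#

  isTeich? : Decidable IsTeich
  isTeich? t with t ≟ 0#
  ... | yes p = yes (inj₁ p)
  ... | no ¬p with pow t (2 ^ r ∸ 1) ≟ 1#
  ...   | yes q = yes (inj₂ q)
  ...   | no ¬q = no λ { (inj₁ p) → ¬p p ; (inj₂ q) → ¬q q }

  private
    both : {P Q : Set} → Dec P → Dec Q → Dec (P × Q)
    both (yes p) (yes q) = yes (p Data.Product., q)
    both (yes p) (no ¬q) = no (λ pq → ¬q (Data.Product.proj₂ pq))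
    both (no ¬p) _       = no (λ pq → ¬p (Data.Product.proj₁ pq))

  -- Teichmüller lift: the unique t ∈ T with π t = u
  lift : F.Carrier → Carrier
  lift u = firstOr (λ t → both (isTeich? t) (π t ≟F u)) 0# elems

  -- x = a + 2b with a, b ∈ T (a = lift (π x), b the unique Teichmüller b with x = a + 2b)
  teichA : Carrier → Carrier
  teichA x = lift (π x)

  teichB : Carrier → Carrier
  teichB x = firstOr (λ t → both (isTeich? t) (x ≟ (teichA x + two * t))) 0# elems

  Tr : Carrier → Carrier
  Tr x = sumFin r (λ i → pow (teichA x) (2 ^ Fin.toℕ i) + two * pow (teichB x) (2 ^ Fin.toℕ i))

module _ {r : ℕ} (F : FiniteField r) (a : Fin r → Fin r → FiniteField.Carrier F) where
  open FiniteField F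

  circ : Carrier → Carrier → Carrier
  circ x y = sumFin r (λ i → sumFin r (λ j →
               a i j * pow x (2 ^ Fin.toℕ i) * pow y (2 ^ Fin.toℕ j)))

  -- (F,+,∘) is a presemifield: ∘ is biadditive by construction; no zero divisors
  IsPresemifield : Set
  IsPresemifield = ∀ x y → circ x y ≡ 0# → x ≡ 0# ⊎ y ≡ 0#

  form : Carrier × Carrier → Carrier × Carrier → Carrier
  form (u Data.Product., v) (u' Data.Product., v') = tr (u * v' - v * u')

  -- symplectic: {(0,y)} and each {(x, x∘y) | x ∈ F} are totally isotropic
  IsSymplectic : Set
  IsSymplectic =
    (∀ y y' → form (0# Data.Product., y) (0# Data.Product., y') ≡ 0#) ×
    (∀ y x x' → form (x Data.Product., circ x y) (x' Data.Product., circ x' y) ≡ 0#)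

  circR : (R : GaloisRing4 r F) → GaloisRing4.Carrier R → GaloisRing4.Carrier R → GaloisRing4.Carrier R
  circR R X Y = sumFin' r (λ i → sumFin' r (λ j →
                  lift (a i j) *' pow' X (2 ^ Fin.toℕ i) *' pow' Y (2 ^ Fin.toℕ j)))
    where
    open GaloisRing4 R using (lift)
      renaming (sumFin to sumFin'; _*_ to _*'_; pow to pow')

-- Tracing through the Frobenius turns tr(x·(z∘y)) into a trilinear form
-- Σ_{k,m,n<r} c_kmn x^(2^k) z^(2^m) y^(2^n) with c_kmn = a_{m-k,n-k}^(2^k) (indices mod r).
-- Isotropy of {(x, x∘y)} and characteristic 2 give (1), so this form is symmetric in x and z;
-- as the monomials X^(2^k), k < r, have degree < q they are linearly independent functions
-- on F, hence c_kmn = c_mkn. In R the trace is additive (a + 2b ↦ a² + 2b², for Teichmüller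
-- a, b, is the Frobenius of R) and equals Σ_k t^(2^k) on Teichmüller t, so Tr(X·(Z∘Y)) is the
-- same trilinear form in the Teichmüller lifts with coefficients lift(c_kmn), since lifting
-- commutes with products and 2^k-th powers. The symmetry of the coefficients gives (2).
module Submission where

open import Defs
open import Level using (0ℓ)
open import Algebra.Bundles using (CommutativeRing)
open import Data.Nat as ℕ using (ℕ; zero; suc; _<_; _∸_)
import Data.Nat.Properties as ℕ
open import Data.Nat.DivMod using (m%n<n; [m+n]%n≡m%n; m<n⇒m%n≡m)
open import Data.Fin as Fin using (Fin; toℕ)
import Data.Fin.Properties as Fin
open import Data.Fin.Permutation using (Permutation; permutation)
open import Data.Product using (∃; _×_; _,_; proj₁; proj₂)
open import Data.Sum using (inj₁; inj₂)
open import Data.Empty using (⊥-elim)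
open import Data.List using (_∷_)
open import Data.List.Membership.Propositional using (_∈_)
open import Data.List.Membership.Propositional.Properties using (∈-map⁺; ∈-allFin)
open import Data.List.Relation.Unary.Any using (here; there)
open import Data.Vec using (Vec; []; _∷_; tabulate)
open import Data.Vec.Relation.Unary.All using (All; []; _∷_)
open import Data.Vec.Relation.Unary.All.Properties using (tabulate⁻)
open import Function using (_∘_)
open import Function.Bundles using (_↔_; Inverse)
open import Relation.Nullary using (¬_; yes; no)
open import Relation.Unary using (Pred; Decidable)
open import Relation.Binary.Definitions using (DecidableEquality; tri<; tri≈; tri>)
open import Relation.Binary.PropositionalEquality

firstOr-satisfies : ∀ {A : Set} {P : Pred A 0ℓ} (P? : Decidable P) d {xs x} → x ∈ xs → P x → P (firstOr P? d xs)
firstOr-satisfies P? d {y ∷ ys} x∈xs Px with P? y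
... | yes Py = Py
firstOr-satisfies P? d {y ∷ ys} (here refl) Px | no ¬Py = ⊥-elim (¬Py Px)
firstOr-satisfies P? d {y ∷ ys} (there x∈ys) Px | no ¬Py = firstOr-satisfies P? d x∈ys Px

∈-elems : ∀ {A : Set} {n} (enum : Fin n ↔ A) x → x ∈ Enum.elems enum
∈-elems enum x = subst (_∈ Enum.elems enum) (Inverse.strictlyInverseˡ enum x)
  (∈-map⁺ (Inverse.to enum) (∈-allFin (Inverse.from enum x)))

↔-to-injective : ∀ {A : Set} {n} (enum : Fin n ↔ A) {i j} → Inverse.to enum i ≡ Inverse.to enum j → i ≡ j
↔-to-injective enum {i} {j} eq =
  trans (sym (Inverse.strictlyInverseʳ enum i)) (trans (cong (Inverse.from enum) eq) (Inverse.strictlyInverseʳ enum j))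

module CRingProperties (K : CRing) where
  open CRing K
  open ≡-Reasoning

  commutativeRing : CommutativeRing _ _
  commutativeRing = record { isCommutativeRing = isCommutativeRing }

  open CommutativeRing commutativeRing public
    using ( +-assoc; +-comm; +-identityˡ; +-identityʳ; -‿inverseˡ; -‿inverseʳ
          ; *-assoc; *-comm; *-identityˡ; *-identityʳ; distribˡ; distribʳ; zeroˡ; zeroʳ )
  open CommutativeRing commutativeRing
    using (semiring; commutativeSemiring; +-group; +-monoid; +-commutativeMonoid)
  open CommutativeRing commutativeRing public using (*-commutativeMonoid)

  open import Algebra.Solver.Ring.NaturalCoefficients.Default commutativeSemiring public
    using (solve; _:+_; _:*_; _:=_)
  open import Algebra.Properties.Group +-group public
    using (x∙y⁻¹≈ε⇒x≈y) renaming (∙-cancelˡ to +-cancelˡ)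
  open import Algebra.Properties.Semiring.Exp semiring public
    using (_^_; ^-homo-*; ^-assocʳ)
  open import Algebra.Properties.CommutativeSemiring.Exp commutativeSemiring public
    using (^-distrib-*)
  open import Algebra.Properties.Monoid.Sum +-monoid
    using (sum; sum-cong-≗; sum-init-last; sum-replicate-zero)
  open import Algebra.Properties.CommutativeMonoid.Sum +-commutativeMonoid
    using () renaming (∑-distrib-+ to sum-distrib-+; ∑-comm to sum-comm)
  open import Algebra.Properties.Semiring.Sum semiring
    using (*-distribˡ-sum; *-distribʳ-sum)

  pow≡^ : ∀ x n → pow x n ≡ x ^ n
  pow≡^ x zero    = refl
  pow≡^ x (suc n) = cong (x *_) (pow≡^ x n)

  infixr 8 _^2^_
  _^2^_ : Carrier → ℕ → Carrier
  x ^2^ k = x ^ (2 ℕ.^ k)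

  ^2^-zero : ∀ x → x ^2^ 0 ≡ x
  ^2^-zero = *-identityʳ

  ^2^-suc : ∀ x k → x ^2^ suc k ≡ x ^2^ k * x ^2^ k
  ^2^-suc x k = trans (^-homo-* x (2 ℕ.^ k) _) (cong (λ n → x ^2^ k * x ^ n) (ℕ.+-identityʳ (2 ℕ.^ k)))

  ^2^-+ : ∀ x k m → x ^2^ (k ℕ.+ m) ≡ (x ^2^ k) ^2^ m
  ^2^-+ x k m = trans (cong (x ^_) (ℕ.^-distribˡ-+-* 2 k m)) (sym (^-assocʳ x (2 ℕ.^ k) (2 ℕ.^ m)))

  ^2^-comm : ∀ x k m → (x ^2^ k) ^2^ m ≡ (x ^2^ m) ^2^ k
  ^2^-comm x k m = trans (sym (^2^-+ x k m)) (trans (cong (x ^2^_) (ℕ.+-comm k m)) (^2^-+ x m k))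

  ^2^-distrib-* : ∀ x y k → (x * y) ^2^ k ≡ x ^2^ k * y ^2^ k
  ^2^-distrib-* x y k = ^-distrib-* x y (2 ℕ.^ k)

  0^2^ : ∀ k → 0# ^2^ k ≡ 0#
  0^2^ zero    = ^2^-zero 0#
  0^2^ (suc k) = trans (^2^-suc 0# k) (trans (cong (_* 0# ^2^ k) (0^2^ k)) (zeroˡ _))

  ∑ : ℕ → (ℕ → Carrier) → Carrier
  ∑ zero    f = 0#
  ∑ (suc n) f = f 0 + ∑ n (f ∘ suc)

  ∑≡sum : ∀ n f → ∑ n f ≡ sum {n} (f ∘ toℕ)
  ∑≡sum zero    f = refl
  ∑≡sum (suc n) f = cong (f 0 +_) (∑≡sum n (f ∘ suc))

  ∑-cong : ∀ n {f g : ℕ → Carrier} → (∀ i → i < n → f i ≡ g i) → ∑ n f ≡ ∑ n g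
  ∑-cong zero    f≗g = refl
  ∑-cong (suc n) f≗g = cong₂ _+_ (f≗g 0 (ℕ.s≤s ℕ.z≤n)) (∑-cong n (λ i i<n → f≗g (suc i) (ℕ.s≤s i<n)))

  ∑-cong-≗ : ∀ n {f g : ℕ → Carrier} → (∀ i → f i ≡ g i) → ∑ n f ≡ ∑ n g
  ∑-cong-≗ n f≗g = ∑-cong n (λ i _ → f≗g i)

  sumFin≡∑ : ∀ n {f : Fin n → Carrier} {g : ℕ → Carrier} → (∀ i → f i ≡ g (toℕ i)) → sumFin n f ≡ ∑ n g
  sumFin≡∑ zero    f≗g = refl
  sumFin≡∑ (suc n) f≗g = cong₂ _+_ (f≗g Fin.zero) (sumFin≡∑ n (f≗g ∘ Fin.suc))

  ∑-zero : ∀ n → ∑ n (λ _ → 0#) ≡ 0#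
  ∑-zero n = trans (∑≡sum n _) (sum-replicate-zero n)

  ∑-init-last : ∀ n f → ∑ (suc n) f ≡ ∑ n f + f n
  ∑-init-last n f = begin
    ∑ (suc n) f                                  ≡⟨ ∑≡sum (suc n) f ⟩
    sum {suc n} (f ∘ toℕ)                        ≡⟨ sum-init-last {n} (f ∘ toℕ) ⟩
    sum {n} (f ∘ toℕ ∘ Fin.inject₁) + f (toℕ (Fin.fromℕ n))
      ≡⟨ cong₂ _+_ (sum-cong-≗ {n} (cong f ∘ Fin.toℕ-inject₁)) (cong f (Fin.toℕ-fromℕ n)) ⟩
    sum {n} (f ∘ toℕ) + f n                      ≡⟨ cong (_+ f n) (sym (∑≡sum n f)) ⟩
    ∑ n f + f n                                  ∎

  ∑-shift : ∀ n (f : ℕ → Carrier) → f n ≡ f 0 → ∑ n (f ∘ suc) ≡ ∑ n f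
  ∑-shift n f fn≡f0 = +-cancelˡ (f 0) _ _ (begin
    f 0 + ∑ n (f ∘ suc)  ≡⟨ ∑-init-last n f ⟩
    ∑ n f + f n          ≡⟨ cong (∑ n f +_) fn≡f0 ⟩
    ∑ n f + f 0          ≡⟨ +-comm _ _ ⟩
    f 0 + ∑ n f          ∎)

  ∑-rotate : ∀ n (f : ℕ → Carrier) → (∀ i → f (i ℕ.+ n) ≡ f i) → ∀ s → ∑ n (λ i → f (i ℕ.+ s)) ≡ ∑ n f
  ∑-rotate n f periodic zero    = ∑-cong-≗ n (λ i → cong f (ℕ.+-identityʳ i))
  ∑-rotate n f periodic (suc s) = begin
    ∑ n (λ i → f (i ℕ.+ suc s))  ≡⟨ ∑-cong-≗ n (λ i → cong f (ℕ.+-suc i s)) ⟩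
    ∑ n (λ i → f (suc i ℕ.+ s))  ≡⟨ ∑-shift n (λ i → f (i ℕ.+ s)) (trans (cong f (ℕ.+-comm n s)) (periodic s)) ⟩
    ∑ n (λ i → f (i ℕ.+ s))      ≡⟨ ∑-rotate n f periodic s ⟩
    ∑ n f                        ∎

  ∑-distrib-+ : ∀ n (f g : ℕ → Carrier) → ∑ n (λ i → f i + g i) ≡ ∑ n f + ∑ n g
  ∑-distrib-+ n f g = trans (∑≡sum n _)
    (trans (sum-distrib-+ {n} (f ∘ toℕ) (g ∘ toℕ)) (sym (cong₂ _+_ (∑≡sum n f) (∑≡sum n g))))

  ∑-comm : ∀ m n (f : ℕ → ℕ → Carrier) → ∑ m (λ i → ∑ n (f i)) ≡ ∑ n (λ j → ∑ m (λ i → f i j))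
  ∑-comm m n f = begin
    ∑ m (λ i → ∑ n (f i))                       ≡⟨ ∑≡sum m _ ⟩
    sum {m} (λ i → ∑ n (f (toℕ i)))             ≡⟨ sum-cong-≗ {m} (λ i → ∑≡sum n (f (toℕ i))) ⟩
    sum {m} (λ i → sum {n} (f (toℕ i) ∘ toℕ))   ≡⟨ sum-comm {m} {n} (λ i j → f (toℕ i) (toℕ j)) ⟩
    sum {n} (λ j → sum {m} (λ i → f (toℕ i) (toℕ j)))
      ≡⟨ sum-cong-≗ {n} (λ j → sym (∑≡sum m (λ i → f i (toℕ j)))) ⟩
    sum {n} (λ j → ∑ m (λ i → f i (toℕ j)))     ≡⟨ sym (∑≡sum n _) ⟩
    ∑ n (λ j → ∑ m (λ i → f i j))               ∎

  *-distribˡ-∑ : ∀ n c (f : ℕ → Carrier) → c * ∑ n f ≡ ∑ n (λ i → c * f i)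
  *-distribˡ-∑ n c f = trans (cong (c *_) (∑≡sum n f)) (trans (*-distribˡ-sum {n} c (f ∘ toℕ)) (sym (∑≡sum n _)))

  *-distribʳ-∑ : ∀ n c (f : ℕ → Carrier) → ∑ n f * c ≡ ∑ n (λ i → f i * c)
  *-distribʳ-∑ n c f = trans (cong (_* c) (∑≡sum n f)) (trans (*-distribʳ-sum {n} c (f ∘ toℕ)) (sym (∑≡sum n _)))

module Characteristic2 (K : CRing) (two≡0 : CRing.two K ≡ CRing.0# K) where
  open CRing K
  open CRingProperties K
  open ≡-Reasoning

  x+x≡0 : ∀ x → x + x ≡ 0#
  x+x≡0 x = begin
    x + x            ≡⟨ cong₂ _+_ (sym (*-identityʳ x)) (sym (*-identityʳ x)) ⟩
    x * 1# + x * 1#  ≡⟨ sym (distribˡ x 1# 1#) ⟩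
    x * two          ≡⟨ cong (x *_) two≡0 ⟩
    x * 0#           ≡⟨ zeroʳ x ⟩
    0#               ∎

  x+y≡0⇒x≡y : ∀ x y → x + y ≡ 0# → x ≡ y
  x+y≡0⇒x≡y x y x+y≡0 = begin
    x              ≡⟨ sym (+-identityʳ x) ⟩
    x + 0#         ≡⟨ cong (x +_) (sym (x+x≡0 y)) ⟩
    x + (y + y)    ≡⟨ sym (+-assoc x y y) ⟩
    (x + y) + y    ≡⟨ cong (_+ y) x+y≡0 ⟩
    0# + y         ≡⟨ +-identityˡ y ⟩
    y              ∎

  -x≡x : ∀ x → - x ≡ x
  -x≡x x = x+y≡0⇒x≡y (- x) x (-‿inverseˡ x)

  ^2^-distrib-+ : ∀ x y k → (x + y) ^2^ k ≡ x ^2^ k + y ^2^ k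
  ^2^-distrib-+ x y zero    = trans (^2^-zero _) (sym (cong₂ _+_ (^2^-zero x) (^2^-zero y)))
  ^2^-distrib-+ x y (suc k) = begin
    (x + y) ^2^ suc k                        ≡⟨ ^2^-suc (x + y) k ⟩
    (x + y) ^2^ k * (x + y) ^2^ k            ≡⟨ cong (λ w → w * w) (^2^-distrib-+ x y k) ⟩
    (u + v) * (u + v)
      ≡⟨ solve 2 (λ u v → (u :+ v) :* (u :+ v) := (u :* u :+ v :* v) :+ (u :* v :+ u :* v)) refl u v ⟩
    (u * u + v * v) + (u * v + u * v)        ≡⟨ trans (cong ((u * u + v * v) +_) (x+x≡0 (u * v))) (+-identityʳ _) ⟩
    u * u + v * v                            ≡⟨ sym (cong₂ _+_ (^2^-suc x k) (^2^-suc y k)) ⟩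
    x ^2^ suc k + y ^2^ suc k                ∎
    where
    u = x ^2^ k
    v = y ^2^ k

  ^2^-distrib-∑ : ∀ n f k → ∑ n f ^2^ k ≡ ∑ n (λ i → f i ^2^ k)
  ^2^-distrib-∑ zero    f k = 0^2^ k
  ^2^-distrib-∑ (suc n) f k = trans (^2^-distrib-+ _ _ k) (cong (f 0 ^2^ k +_) (^2^-distrib-∑ n (f ∘ suc) k))

module FrobeniusForms (K : CRing) (r : ℕ) where
  open CRing K
  open CRingProperties K
  open ≡-Reasoning

  Periodic : (ℕ → Carrier) → Set
  Periodic f = ∀ i → f (i ℕ.+ r) ≡ f i

  Periodic₂ : (ℕ → ℕ → Carrier) → Set
  Periodic₂ A = (∀ j → Periodic (λ i → A i j)) × (∀ i → Periodic (A i))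

  ^2^-periodic : ∀ z → z ^2^ r ≡ z → Periodic (z ^2^_)
  ^2^-periodic z z^2^r≡z k =
    trans (cong (z ^2^_) (ℕ.+-comm k r)) (trans (^2^-+ z r k) (cong (_^2^ k) z^2^r≡z))

  frobForm : (ℕ → ℕ → ℕ → Carrier) → Carrier → Carrier → Carrier → Carrier
  frobForm c x z y = ∑ r λ k → x ^2^ k * ∑ r λ m → z ^2^ m * ∑ r λ n → y ^2^ n * c k m n

  frobForm-swap : ∀ c x z y → frobForm c z x y ≡ frobForm (λ k m n → c m k n) x z y
  frobForm-swap c x z y = begin
    ∑ r (λ k → z ^2^ k * ∑ r λ m → x ^2^ m * N k m)
      ≡⟨ ∑-cong-≗ r (λ k → trans (*-distribˡ-∑ r (z ^2^ k) (λ m → x ^2^ m * N k m))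
                                 (∑-cong-≗ r (λ m → exchange (z ^2^ k) (x ^2^ m) (N k m)))) ⟩
    ∑ r (λ k → ∑ r λ m → x ^2^ m * (z ^2^ k * N k m))
      ≡⟨ ∑-comm r r (λ k m → x ^2^ m * (z ^2^ k * N k m)) ⟩
    ∑ r (λ m → ∑ r λ k → x ^2^ m * (z ^2^ k * N k m))
      ≡⟨ ∑-cong-≗ r (λ m → sym (*-distribˡ-∑ r (x ^2^ m) (λ k → z ^2^ k * N k m))) ⟩
    ∑ r (λ m → x ^2^ m * ∑ r λ k → z ^2^ k * N k m) ∎
    where
    N : ℕ → ℕ → Carrier
    N k m = ∑ r λ n → y ^2^ n * c k m n
    exchange : ∀ a b w → a * (b * w) ≡ b * (a * w)
    exchange = solve 3 (λ a b w → a :* (b :* w) := b :* (a :* w)) refl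

  -- For r-periodic A, the coefficient of x^(2^k) z^(2^m) y^(2^n) in Σ_k (x · Σ_ij A i j z^(2^i) y^(2^j))^(2^k)
  -- is A(m-k, n-k)^(2^k), indices mod r; r ∸ k avoids the truncated subtraction m ∸ k.
  twist : (ℕ → ℕ → Carrier) → ℕ → ℕ → ℕ → Carrier
  twist A k m n = A (m ℕ.+ (r ∸ k)) (n ℕ.+ (r ∸ k)) ^2^ k

  ∑∑-rotate : ∀ f → Periodic₂ f → ∀ k →
              ∑ r (λ i → ∑ r (λ j → f (i ℕ.+ k) (j ℕ.+ k))) ≡ ∑ r (λ m → ∑ r (f m))
  ∑∑-rotate f (periodic₁ , periodic₂) k =
    trans (∑-cong-≗ r (λ i → ∑-rotate r (f (i ℕ.+ k)) (periodic₂ (i ℕ.+ k)) k))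
          (∑-rotate r (λ m → ∑ r (f m)) (λ m → ∑-cong-≗ r (λ n → periodic₁ n m)) k)

  private
    +-∸-cancel : ∀ {k} i → k ℕ.≤ r → i ℕ.+ k ℕ.+ (r ∸ k) ≡ i ℕ.+ r
    +-∸-cancel {k} i k≤r = trans (ℕ.+-assoc i k (r ∸ k)) (cong (i ℕ.+_) (ℕ.m+[n∸m]≡n k≤r))

    +-∸-comm : ∀ k m → m ℕ.+ r ℕ.+ (r ∸ k) ≡ m ℕ.+ (r ∸ k) ℕ.+ r
    +-∸-comm k m = trans (ℕ.+-assoc m r (r ∸ k))
      (trans (cong (m ℕ.+_) (ℕ.+-comm r (r ∸ k))) (sym (ℕ.+-assoc m (r ∸ k) r)))

  twist-periodic : ∀ A → Periodic₂ A → ∀ k → Periodic₂ (twist A k)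
  twist-periodic A (periodic₁ , periodic₂) k =
      (λ n m → cong (_^2^ k) (trans (cong (λ i → A i (n ℕ.+ (r ∸ k))) (+-∸-comm k m)) (periodic₁ _ _)))
    , (λ m n → cong (_^2^ k) (trans (cong (A (m ℕ.+ (r ∸ k))) (+-∸-comm k n)) (periodic₂ _ _)))

  twist-shift : ∀ A → Periodic₂ A → ∀ {k} → k < r → ∀ i j → A i j ^2^ k ≡ twist A k (i ℕ.+ k) (j ℕ.+ k)
  twist-shift A (periodic₁ , periodic₂) {k} k<r i j = cong (_^2^ k) (sym (begin
    A (i ℕ.+ k ℕ.+ (r ∸ k)) (j ℕ.+ k ℕ.+ (r ∸ k))  ≡⟨ cong₂ A (+-∸-cancel i k≤r) (+-∸-cancel j k≤r) ⟩
    A (i ℕ.+ r) (j ℕ.+ r)              ≡⟨ periodic₁ _ _ ⟩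
    A i (j ℕ.+ r)                      ≡⟨ periodic₂ i j ⟩
    A i j                              ∎))
    where k≤r = ℕ.<⇒≤ k<r

  ^2^-monomial : ∀ x a z y i j k →
    (x * (a * z ^2^ i * y ^2^ j)) ^2^ k ≡ x ^2^ k * (z ^2^ (i ℕ.+ k) * (y ^2^ (j ℕ.+ k) * a ^2^ k))
  ^2^-monomial x a z y i j k = begin
    (x * (a * z ^2^ i * y ^2^ j)) ^2^ k
      ≡⟨ ^2^-distrib-* x _ k ⟩
    x ^2^ k * (a * z ^2^ i * y ^2^ j) ^2^ k
      ≡⟨ cong (x ^2^ k *_) (trans (^2^-distrib-* (a * z ^2^ i) _ k) (cong (_* (y ^2^ j) ^2^ k) (^2^-distrib-* a _ k))) ⟩
    x ^2^ k * (a ^2^ k * (z ^2^ i) ^2^ k * (y ^2^ j) ^2^ k)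
      ≡⟨ cong₂ (λ u v → x ^2^ k * (a ^2^ k * u * v)) (sym (^2^-+ z i k)) (sym (^2^-+ y j k)) ⟩
    x ^2^ k * (a ^2^ k * z ^2^ (i ℕ.+ k) * y ^2^ (j ℕ.+ k))
      ≡⟨ solve 4 (λ X A Z Y → X :* (A :* Z :* Y) := X :* (Z :* (Y :* A))) refl _ _ _ _ ⟩
    x ^2^ k * (z ^2^ (i ℕ.+ k) * (y ^2^ (j ℕ.+ k) * a ^2^ k)) ∎

  ∑-frobenius-expand : ∀ A → Periodic₂ A → ∀ x z y → z ^2^ r ≡ z → y ^2^ r ≡ y →
    ∑ r (λ k → ∑ r λ i → ∑ r λ j → (x * (A i j * z ^2^ i * y ^2^ j)) ^2^ k) ≡ frobForm (twist A) x z y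
  ∑-frobenius-expand A A-periodic x z y z-fixed y-fixed = ∑-cong r λ k k<r → begin
    ∑ r (λ i → ∑ r λ j → (x * (A i j * z ^2^ i * y ^2^ j)) ^2^ k)
      ≡⟨ ∑-cong-≗ r (λ i → ∑-cong-≗ r λ j → trans (^2^-monomial x (A i j) z y i j k)
           (cong (λ w → x ^2^ k * (z ^2^ (i ℕ.+ k) * (y ^2^ (j ℕ.+ k) * w))) (twist-shift A A-periodic k<r i j))) ⟩
    ∑ r (λ i → ∑ r λ j → f k (i ℕ.+ k) (j ℕ.+ k))
      ≡⟨ ∑∑-rotate (f k) (f-periodic k) k ⟩
    ∑ r (λ m → ∑ r λ n → f k m n)
      ≡⟨ ∑-cong-≗ r (λ m → trans (sym (*-distribˡ-∑ r (x ^2^ k) (λ n → z ^2^ m * (y ^2^ n * twist A k m n))))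
                                 (cong (x ^2^ k *_) (sym (*-distribˡ-∑ r (z ^2^ m) (λ n → y ^2^ n * twist A k m n))))) ⟩
    ∑ r (λ m → x ^2^ k * (z ^2^ m * ∑ r λ n → y ^2^ n * twist A k m n))
      ≡⟨ sym (*-distribˡ-∑ r (x ^2^ k) (λ m → z ^2^ m * ∑ r λ n → y ^2^ n * twist A k m n)) ⟩
    x ^2^ k * ∑ r (λ m → z ^2^ m * ∑ r λ n → y ^2^ n * twist A k m n) ∎
    where
    f : ℕ → ℕ → ℕ → Carrier
    f k m n = x ^2^ k * (z ^2^ m * (y ^2^ n * twist A k m n))
    f-periodic : ∀ k → Periodic₂ (f k)
    f-periodic k = let (t₁ , t₂) = twist-periodic A A-periodic k in
        (λ n m → cong₂ (λ u v → x ^2^ k * (u * (y ^2^ n * v))) (^2^-periodic z z-fixed m) (t₁ n m))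
      , (λ m n → cong₂ (λ u v → x ^2^ k * (z ^2^ m * (u * v))) (^2^-periodic y y-fixed n) (t₂ m n))

  *-sumFin²≡∑² : ∀ (c : Fin r → Fin r → Carrier) (C : ℕ → ℕ → Carrier) →
                 (∀ i j → c i j ≡ C (toℕ i) (toℕ j)) → ∀ x z y →
    x * sumFin r (λ i → sumFin r λ j → c i j * pow z (2 ℕ.^ toℕ i) * pow y (2 ℕ.^ toℕ j))
      ≡ ∑ r (λ i → ∑ r λ j → x * (C i j * z ^2^ i * y ^2^ j))
  *-sumFin²≡∑² c C c≡C x z y = begin
    x * sumFin r (λ i → sumFin r λ j → c i j * pow z (2 ℕ.^ toℕ i) * pow y (2 ℕ.^ toℕ j))
      ≡⟨ cong (x *_) (sumFin≡∑ r λ i → sumFin≡∑ r λ j →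
           cong₂ _*_ (cong₂ _*_ (c≡C i j) (pow≡^ z (2 ℕ.^ toℕ i))) (pow≡^ y (2 ℕ.^ toℕ j))) ⟩
    x * ∑ r (λ i → ∑ r λ j → C i j * z ^2^ i * y ^2^ j)
      ≡⟨ *-distribˡ-∑ r x _ ⟩
    ∑ r (λ i → x * ∑ r λ j → C i j * z ^2^ i * y ^2^ j)
      ≡⟨ ∑-cong-≗ r (λ i → *-distribˡ-∑ r x _) ⟩
    ∑ r (λ i → ∑ r λ j → x * (C i j * z ^2^ i * y ^2^ j)) ∎

  frobForm-cong : ∀ {c d} → (∀ k m n → k < r → m < r → n < r → c k m n ≡ d k m n) →
                  ∀ x z y → frobForm c x z y ≡ frobForm d x z y
  frobForm-cong c≡d x z y = ∑-cong r λ k k<r → cong (x ^2^ k *_) (∑-cong r λ m m<r → cong (z ^2^ m *_)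
                              (∑-cong r λ n n<r → cong (y ^2^ n *_) (c≡d k m n k<r m<r n<r)))

module FiniteFieldProperties {r : ℕ} (F : FiniteField r) where
  open FiniteField F
  open CRingProperties ring
  open ≡-Reasoning

  infix 4 _≟_
  _≟_ : DecidableEquality Carrier
  _≟_ = Enum._≟_ card

  x*y≡0⇒y≡0 : ∀ {x y} → x ≢ 0# → x * y ≡ 0# → y ≡ 0#
  x*y≡0⇒y≡0 {x} {y} x≢0 xy≡0 = begin
    y              ≡⟨ sym (*-identityˡ y) ⟩
    1# * y         ≡⟨ cong (_* y) (sym (trans (*-comm x⁻¹ x) xx⁻¹≡1)) ⟩
    (x⁻¹ * x) * y  ≡⟨ *-assoc x⁻¹ x y ⟩
    x⁻¹ * (x * y)  ≡⟨ cong (x⁻¹ *_) xy≡0 ⟩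
    x⁻¹ * 0#       ≡⟨ zeroʳ x⁻¹ ⟩
    0#             ∎
    where
    x⁻¹ = proj₁ (inverse x x≢0)
    xx⁻¹≡1 = proj₂ (inverse x x≢0)

  *-cancelˡ-nonZero : ∀ {x} y z → x ≢ 0# → x * y ≡ x * z → y ≡ z
  *-cancelˡ-nonZero {x} y z x≢0 xy≡xz = x∙y⁻¹≈ε⇒x≈y y z (x*y≡0⇒y≡0 x≢0 (begin
    x * (y - z)        ≡⟨ distribˡ x y (- z) ⟩
    x * y + x * - z    ≡⟨ cong (_+ x * - z) xy≡xz ⟩
    x * z + x * - z    ≡⟨ sym (distribˡ x z (- z)) ⟩
    x * (z - z)        ≡⟨ cong (x *_) (-‿inverseʳ z) ⟩
    x * 0#             ≡⟨ zeroʳ x ⟩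
    0#                 ∎))

  -- Multiplication by u ≠ 0 permutes the field, and multiplies the product G of all elements
  -- (with 0 replaced by 1) by u^n; as G ≠ 0, u^n = 1.
  module Fermat {n : ℕ} (enum : Fin (suc n) ↔ Carrier) {u : Carrier} (u≢0 : u ≢ 0#) where
    open Inverse enum using (to; from; strictlyInverseˡ; strictlyInverseʳ)
    open import Algebra.Properties.CommutativeMonoid.Sum *-commutativeMonoid
      renaming (sum to ∏; sum-permute to ∏-permute; sum-remove to ∏-remove; ∑-distrib-+ to ∏-distrib-*;
                sum-replicate to ∏-replicate; sum-cong-≗ to ∏-cong-≗)
      using ()

    orOne : Carrier → Carrier
    orOne x with x ≟ 0#
    ... | yes _ = 1#
    ... | no  _ = x

    scale : Carrier → Carrier
    scale x with x ≟ 0#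
    ... | yes _ = 1#
    ... | no  _ = u

    orOne-nonZero : ∀ x → orOne x ≢ 0#
    orOne-nonZero x with x ≟ 0#
    ... | yes _   = nontrivial
    ... | no  x≢0 = x≢0

    orOne-* : ∀ x → orOne (u * x) ≡ scale x * orOne x
    orOne-* x with x ≟ 0# | u * x ≟ 0#
    ... | yes _   | yes _    = sym (*-identityʳ 1#)
    ... | yes x≡0 | no ux≢0  = ⊥-elim (ux≢0 (trans (cong (u *_) x≡0) (zeroʳ u)))
    ... | no  x≢0 | yes ux≡0 = ⊥-elim (x≢0 (x*y≡0⇒y≡0 u≢0 ux≡0))
    ... | no  _   | no  _    = refl

    scale-0 : scale 0# ≡ 1#
    scale-0 with 0# ≟ 0#
    ... | yes _   = refl
    ... | no  0≢0 = ⊥-elim (0≢0 refl)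

    scale-nonZero : ∀ {x} → x ≢ 0# → scale x ≡ u
    scale-nonZero {x} x≢0 with x ≟ 0#
    ... | yes x≡0 = ⊥-elim (x≢0 x≡0)
    ... | no  _   = refl

    ∏-nonZero : ∀ {m} (f : Fin m → Carrier) → (∀ i → f i ≢ 0#) → ∏ f ≢ 0#
    ∏-nonZero {zero}  f f≢0 = nontrivial
    ∏-nonZero {suc m} f f≢0 ∏≡0 = ∏-nonZero (f ∘ Fin.suc) (f≢0 ∘ Fin.suc) (x*y≡0⇒y≡0 (f≢0 Fin.zero) ∏≡0)

    ∏-scale : ∏ (scale ∘ to) ≡ u ^ n
    ∏-scale = begin
      ∏ (scale ∘ to)                                ≡⟨ ∏-remove {i = from 0#} (scale ∘ to) ⟩
      scale (to (from 0#)) * ∏ (scale ∘ to ∘ Fin.punchIn (from 0#))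
        ≡⟨ cong₂ _*_ (trans (cong scale (strictlyInverseˡ 0#)) scale-0)
                     (∏-cong-≗ {n} λ j → scale-nonZero (to-punchIn≢0 j)) ⟩
      1# * ∏ {n} (λ _ → u)                          ≡⟨ *-identityˡ _ ⟩
      ∏ {n} (λ _ → u)                                   ≡⟨ ∏-replicate n ⟩
      u ^ n                                         ∎
      where
      to-punchIn≢0 : ∀ j → to (Fin.punchIn (from 0#) j) ≢ 0#
      to-punchIn≢0 j to≡0 = Fin.punchInᵢ≢i (from 0#) j (trans (sym (strictlyInverseʳ _)) (cong from to≡0))

    u⁻¹ = proj₁ (inverse u u≢0)

    multiplyBy-u : Permutation (suc n) (suc n)
    multiplyBy-u = permutation (λ i → from (u * to i)) (λ i → from (u⁻¹ * to i)) (cancel (proj₂ (inverse u u≢0)))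
      (cancel (trans (*-comm u⁻¹ u) (proj₂ (inverse u u≢0))))
      where
      cancel : ∀ {a b} → a * b ≡ 1# → ∀ i → from (a * to (from (b * to i))) ≡ i
      cancel {a} {b} ab≡1 i = begin
        from (a * to (from (b * to i)))  ≡⟨ cong (λ w → from (a * w)) (strictlyInverseˡ _) ⟩
        from (a * (b * to i))            ≡⟨ cong from (sym (*-assoc a b (to i))) ⟩
        from (a * b * to i)              ≡⟨ cong (λ w → from (w * to i)) ab≡1 ⟩
        from (1# * to i)                 ≡⟨ cong from (*-identityˡ (to i)) ⟩
        from (to i)                      ≡⟨ strictlyInverseʳ i ⟩
        i                                ∎

    fermat : u ^ n ≡ 1#
    fermat = *-cancelˡ-nonZero {∏ (orOne ∘ to)} (u ^ n) 1# (∏-nonZero (orOne ∘ to) (orOne-nonZero ∘ to)) (begin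
      G * u ^ n                              ≡⟨ *-comm G _ ⟩
      u ^ n * G                              ≡⟨ cong (_* G) (sym ∏-scale) ⟩
      ∏ (scale ∘ to) * G                     ≡⟨ sym (∏-distrib-* (scale ∘ to) (orOne ∘ to)) ⟩
      ∏ (λ i → scale (to i) * orOne (to i))
        ≡⟨ ∏-cong-≗ (λ i → trans (sym (orOne-* (to i))) (cong orOne (sym (strictlyInverseˡ _)))) ⟩
      ∏ (λ i → orOne (to (from (u * to i)))) ≡⟨ sym (∏-permute (orOne ∘ to) multiplyBy-u) ⟩
      G                                      ≡⟨ sym (*-identityʳ G) ⟩
      G * 1#                                 ∎)
      where
      G = ∏ (orOne ∘ to)

  q : ℕ
  q = 2 ℕ.^ r

  q≡1+[q∸1] : q ≡ suc (q ∸ 1)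
  q≡1+[q∸1] = sym (ℕ.m+[n∸m]≡n {1} {q} (ℕ.m^n>0 2 r))

  x^q≡x : ∀ x → x ^ q ≡ x
  x^q≡x x with x ≟ 0#
  ... | yes x≡0 = begin
    x ^ q              ≡⟨ cong₂ _^_ x≡0 q≡1+[q∸1] ⟩
    0# * 0# ^ (q ∸ 1)  ≡⟨ zeroˡ _ ⟩
    0#                 ≡⟨ sym x≡0 ⟩
    x                  ∎
  ... | no x≢0 = begin
    x ^ q              ≡⟨ cong (x ^_) q≡1+[q∸1] ⟩
    x * x ^ (q ∸ 1)    ≡⟨ cong (x *_) (Fermat.fermat (subst (λ m → Fin m ↔ Carrier) q≡1+[q∸1] card) x≢0) ⟩
    x * 1#             ≡⟨ *-identityʳ x ⟩
    x                  ∎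

  -- Polynomials as coefficient vectors, constant term first.
  eval : ∀ {n} → Vec Carrier n → Carrier → Carrier
  eval []       x = 0#
  eval (a ∷ as) x = a + x * eval as x

  divideBy : ∀ {n} → Vec Carrier (suc n) → Carrier → Vec Carrier n
  divideBy (a ∷ [])     c = []
  divideBy (a ∷ b ∷ bs) c = eval (b ∷ bs) c ∷ divideBy (b ∷ bs) c

  eval-divideBy : ∀ {n} (p : Vec Carrier (suc n)) c x → eval p x ≡ (x - c) * eval (divideBy p c) x + eval p c
  eval-divideBy (a ∷ []) c x = trans (cong (a +_) (zeroʳ x))
    (sym (trans (cong₂ (λ u v → u + (a + v)) (zeroʳ (x - c)) (zeroʳ c)) (+-identityˡ _)))
  eval-divideBy (a ∷ b ∷ bs) c x = begin
    a + x * p x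
      ≡⟨ cong (λ t → a + x * t) (eval-divideBy (b ∷ bs) c x) ⟩
    a + x * ((x - c) * Q + p c)
      ≡⟨ sym (trans (cong (a + x * ((x - c) * Q + p c) +_) (trans (cong (_* p c) (-‿inverseˡ c)) (zeroˡ (p c))))
                    (+-identityʳ _)) ⟩
    a + x * ((x + - c) * Q + p c) + (- c + c) * p c
      -- the solver has no negation: - c enters as an atom d, and d + c = 0 was added above
      ≡⟨ solve 6 (λ a x d c Q P → a :+ x :* ((x :+ d) :* Q :+ P) :+ (d :+ c) :* P
                      := (x :+ d) :* (P :+ x :* Q) :+ (a :+ c :* P)) refl a x (- c) c Q (p c) ⟩
    (x - c) * (p c + x * Q) + (a + c * p c) ∎
    where
    p = eval (b ∷ bs)
    Q = eval (divideBy (b ∷ bs) c) x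

  divideBy-zero : ∀ {n} (p : Vec Carrier (suc n)) c → eval p c ≡ 0# → All (_≡ 0#) (divideBy p c) → All (_≡ 0#) p
  divideBy-zero (a ∷ []) c pc≡0 [] = trans (sym (trans (cong (a +_) (zeroʳ c)) (+-identityʳ a))) pc≡0 ∷ []
  divideBy-zero (a ∷ b ∷ bs) c pc≡0 (qc≡0 ∷ qs≡0) =
    trans (sym (trans (cong (λ t → a + c * t) qc≡0) (trans (cong (a +_) (zeroʳ c)) (+-identityʳ a)))) pc≡0
    ∷ divideBy-zero (b ∷ bs) c qc≡0 qs≡0

  vanishing⇒zero : ∀ {n} (p : Vec Carrier n) (roots : Fin n → Carrier) →
                   (∀ {i j} → roots i ≡ roots j → i ≡ j) → (∀ i → eval p (roots i) ≡ 0#) → All (_≡ 0#) p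
  vanishing⇒zero []      roots distinct vanish = []
  vanishing⇒zero (a ∷ p) roots distinct vanish =
    divideBy-zero (a ∷ p) c (vanish Fin.zero)
      (vanishing⇒zero (divideBy (a ∷ p) c) (roots ∘ Fin.suc) (Fin.suc-injective ∘ distinct) quotient-vanishes)
    where
    c = roots Fin.zero
    quotient-vanishes : ∀ j → eval (divideBy (a ∷ p) c) (roots (Fin.suc j)) ≡ 0#
    quotient-vanishes j = x*y≡0⇒y≡0 root-c≢0 (begin
      (x - c) * Q                    ≡⟨ sym (+-identityʳ _) ⟩
      (x - c) * Q + 0#               ≡⟨ cong ((x - c) * Q +_) (sym (vanish Fin.zero)) ⟩
      (x - c) * Q + eval (a ∷ p) c   ≡⟨ sym (eval-divideBy (a ∷ p) c x) ⟩
      eval (a ∷ p) x                 ≡⟨ vanish (Fin.suc j) ⟩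
      0#                             ∎)
      where
      x = roots (Fin.suc j)
      Q = eval (divideBy (a ∷ p) c) x
      root-c≢0 : x - c ≢ 0#
      root-c≢0 x-c≡0 with distinct (x∙y⁻¹≈ε⇒x≈y x c x-c≡0)
      ... | ()

  eval-tabulate : ∀ n (g : ℕ → Carrier) x → eval (tabulate {n = n} (g ∘ toℕ)) x ≡ ∑ n (λ m → g m * x ^ m)
  eval-tabulate zero    g x = refl
  eval-tabulate (suc n) g x = cong₂ _+_ (sym (*-identityʳ (g 0))) (begin
    x * eval (tabulate {n = n} (g ∘ suc ∘ toℕ)) x  ≡⟨ cong (x *_) (eval-tabulate n (g ∘ suc) x) ⟩
    x * ∑ n (λ m → g (suc m) * x ^ m)         ≡⟨ *-distribˡ-∑ n x (λ m → g (suc m) * x ^ m) ⟩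
    ∑ n (λ m → x * (g (suc m) * x ^ m))
      ≡⟨ ∑-cong-≗ n (λ m → solve 3 (λ x a b → x :* (a :* b) := a :* (x :* b)) refl x (g (suc m)) (x ^ m)) ⟩
    ∑ n (λ m → g (suc m) * x ^ suc m)         ∎)

  δ : ℕ → ℕ → Carrier
  δ zero    zero    = 1#
  δ zero    (suc _) = 0#
  δ (suc _) zero    = 0#
  δ (suc m) (suc n) = δ m n

  δ-diag : ∀ m → δ m m ≡ 1#
  δ-diag zero    = refl
  δ-diag (suc m) = δ-diag m

  δ-offDiag : ∀ {m n} → m ≢ n → δ m n ≡ 0#
  δ-offDiag {zero}  {zero}  m≢n = ⊥-elim (m≢n refl)
  δ-offDiag {zero}  {suc n} m≢n = refl
  δ-offDiag {suc m} {zero}  m≢n = refl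
  δ-offDiag {suc m} {suc n} m≢n = δ-offDiag (m≢n ∘ cong suc)

  ∑-δ : ∀ n t (g : ℕ → Carrier) → t < n → ∑ n (λ m → δ m t * g m) ≡ g t
  ∑-δ (suc n) zero    g _ = begin
    1# * g 0 + ∑ n (λ m → 0# * g (suc m))
      ≡⟨ cong₂ _+_ (*-identityˡ (g 0)) (trans (∑-cong-≗ n (λ m → zeroˡ (g (suc m)))) (∑-zero n)) ⟩
    g 0 + 0#                               ≡⟨ +-identityʳ (g 0) ⟩
    g 0                                    ∎
  ∑-δ (suc n) (suc t) g (ℕ.s≤s t<n) = begin
    0# * g 0 + ∑ n (λ m → δ m t * g (suc m))  ≡⟨ cong (_+ ∑ n (λ m → δ m t * g (suc m))) (zeroˡ (g 0)) ⟩
    0# + ∑ n (λ m → δ m t * g (suc m))        ≡⟨ +-identityˡ _ ⟩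
    ∑ n (λ m → δ m t * g (suc m))             ≡⟨ ∑-δ n t (g ∘ suc) t<n ⟩
    g (suc t)                                 ∎

  private
    2^-injective : ∀ {a b} → 2 ℕ.^ a ≡ 2 ℕ.^ b → a ≡ b
    2^-injective {a} {b} eq with ℕ.<-cmp a b
    ... | tri< a<b _ _ = ⊥-elim (ℕ.<⇒≢ (ℕ.^-monoʳ-< 2 (ℕ.s≤s (ℕ.s≤s ℕ.z≤n)) a<b) eq)
    ... | tri≈ _ a≡b _ = a≡b
    ... | tri> _ _ b<a = ⊥-elim (ℕ.<⇒≢ (ℕ.^-monoʳ-< 2 (ℕ.s≤s (ℕ.s≤s ℕ.z≤n)) b<a) (sym eq))

  δ-2^ : ∀ a b → δ (2 ℕ.^ a) (2 ℕ.^ b) ≡ δ b a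
  δ-2^ a b with a ℕ.≟ b
  ... | yes refl = trans (δ-diag (2 ℕ.^ a)) (sym (δ-diag a))
  ... | no  a≢b  = trans (δ-offDiag (a≢b ∘ 2^-injective)) (sym (δ-offDiag (a≢b ∘ sym)))

  -- ∑ₖ e k X^(2^k) has degree < q and vanishes on all q elements of F.
  frobenius-independent : ∀ (e : ℕ → Carrier) → (∀ x → ∑ r (λ k → x ^2^ k * e k) ≡ 0#) →
                          ∀ k → k < r → e k ≡ 0#
  frobenius-independent e vanish k k<r = begin
    e k                                       ≡⟨ sym (∑-δ r k e k<r) ⟩
    ∑ r (λ k′ → δ k′ k * e k′)                ≡⟨ ∑-cong-≗ r (λ k′ → cong (_* e k′) (sym (δ-2^ k k′))) ⟩
    coefficient (2 ℕ.^ k)                     ≡⟨ cong coefficient (sym (Fin.toℕ-fromℕ< (2^<q k<r))) ⟩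
    coefficient (toℕ (Fin.fromℕ< (2^<q k<r))) ≡⟨ tabulate⁻ coefficients-zero (Fin.fromℕ< (2^<q k<r)) ⟩
    0#                                        ∎
    where
    coefficient : ℕ → Carrier
    coefficient m = ∑ r (λ k′ → δ m (2 ℕ.^ k′) * e k′)
    2^<q : ∀ {k} → k < r → 2 ℕ.^ k < q
    2^<q = ℕ.^-monoʳ-< 2 (ℕ.s≤s (ℕ.s≤s ℕ.z≤n))
    polynomial-vanishes : ∀ x → eval (tabulate {n = q} (coefficient ∘ toℕ)) x ≡ 0#
    polynomial-vanishes x = begin
      eval (tabulate {n = q} (coefficient ∘ toℕ)) x                    ≡⟨ eval-tabulate q coefficient x ⟩
      ∑ q (λ m → coefficient m * x ^ m)
        ≡⟨ ∑-cong-≗ q (λ m → trans (*-distribʳ-∑ r (x ^ m) (λ k′ → δ m (2 ℕ.^ k′) * e k′))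
                                   (∑-cong-≗ r (λ k′ → *-assoc (δ m (2 ℕ.^ k′)) (e k′) (x ^ m)))) ⟩
      ∑ q (λ m → ∑ r (λ k′ → δ m (2 ℕ.^ k′) * (e k′ * x ^ m)))
        ≡⟨ ∑-comm q r (λ m k′ → δ m (2 ℕ.^ k′) * (e k′ * x ^ m)) ⟩
      ∑ r (λ k′ → ∑ q (λ m → δ m (2 ℕ.^ k′) * (e k′ * x ^ m)))
        ≡⟨ ∑-cong r (λ k′ k′<r → ∑-δ q (2 ℕ.^ k′) (λ m → e k′ * x ^ m) (2^<q k′<r)) ⟩
      ∑ r (λ k′ → e k′ * x ^2^ k′)
        ≡⟨ ∑-cong-≗ r (λ k′ → *-comm (e k′) (x ^2^ k′)) ⟩
      ∑ r (λ k′ → x ^2^ k′ * e k′)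
        ≡⟨ vanish x ⟩
      0# ∎
    coefficients-zero : All (_≡ 0#) (tabulate {n = q} (coefficient ∘ toℕ))
    coefficients-zero = vanishing⇒zero _ (Inverse.to card) (↔-to-injective card) (polynomial-vanishes ∘ Inverse.to card)

module BinaryFieldProperties {r : ℕ} (F : FiniteField r) (two≡0 : FiniteField.two F ≡ FiniteField.0# F) where
  open FiniteField F
  open CRingProperties ring
  open Characteristic2 ring two≡0
  open FiniteFieldProperties F using (frobenius-independent)
  open FrobeniusForms ring r
  open ≡-Reasoning

  frobenius-coefficients-unique : ∀ (b b′ : ℕ → Carrier) →
    (∀ x → ∑ r (λ k → x ^2^ k * b k) ≡ ∑ r (λ k → x ^2^ k * b′ k)) → ∀ k → k < r → b k ≡ b′ k
  frobenius-coefficients-unique b b′ same k k<r =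
    x+y≡0⇒x≡y (b k) (b′ k) (frobenius-independent (λ k → b k + b′ k) difference-vanishes k k<r)
    where
    difference-vanishes : ∀ x → ∑ r (λ k → x ^2^ k * (b k + b′ k)) ≡ 0#
    difference-vanishes x = begin
      ∑ r (λ k → x ^2^ k * (b k + b′ k))
        ≡⟨ ∑-cong-≗ r (λ k → distribˡ (x ^2^ k) (b k) (b′ k)) ⟩
      ∑ r (λ k → x ^2^ k * b k + x ^2^ k * b′ k)                 ≡⟨ ∑-distrib-+ r _ _ ⟩
      ∑ r (λ k → x ^2^ k * b k) + ∑ r (λ k → x ^2^ k * b′ k)     ≡⟨ cong (_+ _) (same x) ⟩
      ∑ r (λ k → x ^2^ k * b′ k) + ∑ r (λ k → x ^2^ k * b′ k)    ≡⟨ x+x≡0 _ ⟩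
      0#                                                         ∎

  frobForm-injective : ∀ c d → (∀ x z y → frobForm c x z y ≡ frobForm d x z y) →
                       ∀ k m n → k < r → m < r → n < r → c k m n ≡ d k m n
  frobForm-injective c d same k m n k<r m<r n<r =
    frobenius-coefficients-unique (c k m) (d k m) (λ y →
      frobenius-coefficients-unique (λ m → ∑ r λ n → y ^2^ n * c k m n) (λ m → ∑ r λ n → y ^2^ n * d k m n) (λ z →
        frobenius-coefficients-unique (λ k → ∑ r λ m → z ^2^ m * ∑ r λ n → y ^2^ n * c k m n)
                                      (λ k → ∑ r λ m → z ^2^ m * ∑ r λ n → y ^2^ n * d k m n)
                                      (λ x → same x z y) k k<r) m m<r) n n<r

  tr≡∑ : ∀ x → tr x ≡ ∑ r (x ^2^_)
  tr≡∑ x = sumFin≡∑ r (λ k → pow≡^ x (2 ℕ.^ toℕ k))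

  tr-distrib-+ : ∀ x y → tr (x + y) ≡ tr x + tr y
  tr-distrib-+ x y = begin
    tr (x + y)                        ≡⟨ tr≡∑ (x + y) ⟩
    ∑ r (λ k → (x + y) ^2^ k)         ≡⟨ ∑-cong-≗ r (^2^-distrib-+ x y) ⟩
    ∑ r (λ k → x ^2^ k + y ^2^ k)     ≡⟨ ∑-distrib-+ r (x ^2^_) (y ^2^_) ⟩
    ∑ r (x ^2^_) + ∑ r (y ^2^_)       ≡⟨ sym (cong₂ _+_ (tr≡∑ x) (tr≡∑ y)) ⟩
    tr x + tr y                       ∎

  symplectic⇒tr-symmetric : ∀ a → IsSymplectic F a → ∀ x y z → tr (x * circ F a z y) ≡ tr (z * circ F a x y)
  symplectic⇒tr-symmetric a (_ , isotropic) x y z =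
    trans (x+y≡0⇒x≡y _ _ sum≡0) (cong tr (*-comm (circ F a x y) z))
    where
    sum≡0 : tr (x * circ F a z y) + tr (circ F a x y * z) ≡ 0#
    sum≡0 = begin
      tr (x * circ F a z y) + tr (circ F a x y * z)     ≡⟨ sym (tr-distrib-+ _ _) ⟩
      tr (x * circ F a z y + circ F a x y * z)          ≡⟨ cong (λ w → tr (x * circ F a z y + w)) (sym (-x≡x _)) ⟩
      tr (x * circ F a z y - circ F a x y * z)          ≡⟨ isotropic y x z ⟩
      0#                                                ∎

module GaloisRingProperties {r′ : ℕ} {F : FiniteField (suc r′)} (R : GaloisRing4 (suc r′) F) where
  open GaloisRing4 R
  open CRingProperties ring
  module Fᴾ = CRingProperties F.ring
  open ≡-Reasoning

  open FiniteFieldProperties F using (q; q≡1+[q∸1]) renaming (x^q≡x to x^q≡xᶠ)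

  r : ℕ
  r = suc r′

  two≡0ᶠ : F.two ≡ F.0#
  two≡0ᶠ = begin
    F.1# F.+ F.1#     ≡⟨ sym (cong₂ F._+_ π-1 π-1) ⟩
    π 1# F.+ π 1#     ≡⟨ sym (π-+ 1# 1#) ⟩
    π two             ≡⟨ cong π (sym (*-identityʳ two)) ⟩
    π (two * 1#)      ≡⟨ ker-π 1# ⟩
    F.0#              ∎

  open Characteristic2 F.ring two≡0ᶠ using (x+x≡0; x+y≡0⇒x≡y)

  π-0 : π 0# ≡ F.0#
  π-0 = trans (cong π (sym (zeroʳ two))) (ker-π 0#)

  π-‿ : ∀ x → π (- x) ≡ π x
  π-‿ x = x+y≡0⇒x≡y _ _ (trans (sym (π-+ (- x) x)) (trans (cong π (-‿inverseˡ x)) π-0))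

  π-^ : ∀ x n → π (x ^ n) ≡ π x Fᴾ.^ n
  π-^ x zero    = π-1
  π-^ x (suc n) = trans (π-* x _) (cong (π x F.*_) (π-^ x n))

  π-^2^ : ∀ x k → π (x ^2^ k) ≡ π x Fᴾ.^2^ k
  π-^2^ x k = π-^ x (2 ℕ.^ k)

  π-+2* : ∀ a b → π (a + two * b) ≡ π a
  π-+2* a b = trans (π-+ a _) (trans (cong (π a F.+_) (ker-π b)) (Fᴾ.+-identityʳ _))

  π-difference : ∀ {a b} → π a ≡ π b → ∃ λ w → a ≡ b + two * w
  π-difference {a} {b} πa≡πb with π-ker (a - b) π[a-b]≡0
    where
    π[a-b]≡0 : π (a - b) ≡ F.0#
    π[a-b]≡0 = trans (π-+ a (- b)) (trans (cong₂ F._+_ πa≡πb (π-‿ b)) (x+x≡0 (π b)))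
  ... | w , a-b≡2w = w , (begin
    a              ≡⟨ sym (+-identityʳ a) ⟩
    a + 0#         ≡⟨ cong (a +_) (sym (-‿inverseˡ b)) ⟩
    a + (- b + b)  ≡⟨ sym (+-assoc a (- b) b) ⟩
    (a - b) + b    ≡⟨ +-comm _ b ⟩
    b + (a - b)    ≡⟨ cong (b +_) a-b≡2w ⟩
    b + two * w    ∎)

  two*two≡0 : two * two ≡ 0#
  two*two≡0 = trans (distribˡ two 1# 1#) (trans (cong₂ _+_ (*-identityʳ two) (*-identityʳ two)) char4)

  two*x+two*x≡0 : ∀ x → two * x + two * x ≡ 0#
  two*x+two*x≡0 x = trans (sym (distribʳ x two two)) (trans (cong (_* x) char4) (zeroˡ x))

  two*≡+ : ∀ x → two * x ≡ x + x
  two*≡+ x = trans (distribʳ x 1# 1#) (cong₂ _+_ (*-identityˡ x) (*-identityˡ x))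

  two*-cong-π : ∀ {x y} → π x ≡ π y → two * x ≡ two * y
  two*-cong-π {x} {y} πx≡πy with π-difference πx≡πy
  ... | w , x≡y+2w = begin
    two * x                      ≡⟨ cong (two *_) x≡y+2w ⟩
    two * (y + two * w)          ≡⟨ distribˡ two y _ ⟩
    two * y + two * (two * w)
      ≡⟨ cong (two * y +_) (trans (sym (*-assoc two two w)) (trans (cong (_* w) two*two≡0) (zeroˡ w))) ⟩
    two * y + 0#                 ≡⟨ +-identityʳ _ ⟩
    two * y                      ∎

  two*-injective-π : ∀ {x y} → two * x ≡ two * y → π x ≡ π y
  two*-injective-π {x} {y} 2x≡2y = x+y≡0⇒x≡y _ _ (begin
    π x F.+ π y        ≡⟨ cong (π x F.+_) (sym (π-‿ y)) ⟩
    π x F.+ π (- y)    ≡⟨ sym (π-+ x (- y)) ⟩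
    π (x - y)          ≡⟨ π[x-y]≡0 ⟩
    F.0#               ∎)
    where
    two*[x-y]≡0 : two * (x - y) ≡ 0#
    two*[x-y]≡0 = trans (distribˡ two x (- y)) (trans (cong₂ _+_ 2x≡2y (two*-cong-π (π-‿ y))) (two*x+two*x≡0 y))
    π[x-y]≡0 : π (x - y) ≡ F.0#
    π[x-y]≡0 with Enum._≟_ F.card (π (x - y)) F.0#
    ... | yes π≡0 = π≡0
    ... | no  π≢0 with local (x - y) π≢0
    ...   | w , [x-y]w≡1 = ⊥-elim (two≢0 (begin
      two                   ≡⟨ sym (*-identityʳ two) ⟩
      two * 1#              ≡⟨ cong (two *_) (sym [x-y]w≡1) ⟩
      two * ((x - y) * w)   ≡⟨ sym (*-assoc two _ w) ⟩
      two * (x - y) * w     ≡⟨ cong (_* w) two*[x-y]≡0 ⟩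
      0# * w                ≡⟨ zeroˡ w ⟩
      0#                    ∎))

  square-+2* : ∀ x y → (x + two * y) * (x + two * y) ≡ x * x
  square-+2* x y = begin
    (x + two * y) * (x + two * y)
      ≡⟨ solve 3 (λ x t y → (x :+ t :* y) :* (x :+ t :* y)
                              := x :* x :+ ((t :+ t) :* (x :* y) :+ (t :* t) :* (y :* y))) refl x two y ⟩
    x * x + ((two + two) * (x * y) + (two * two) * (y * y))
      ≡⟨ cong₂ (λ a b → x * x + (a * (x * y) + b * (y * y))) char4 two*two≡0 ⟩
    x * x + (0# * (x * y) + 0# * (y * y))
      ≡⟨ cong (x * x +_) (trans (cong₂ _+_ (zeroˡ _) (zeroˡ _)) (+-identityʳ 0#)) ⟩
    x * x + 0#
      ≡⟨ +-identityʳ _ ⟩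
    x * x ∎

  ^q-+2* : ∀ x y → (x + two * y) ^ q ≡ x ^ q
  ^q-+2* x y = begin
    (x + two * y) ^ (2 ℕ.* 2 ℕ.^ r′)   ≡⟨ sym (^-assocʳ _ 2 (2 ℕ.^ r′)) ⟩
    ((x + two * y) ^ 2) ^ (2 ℕ.^ r′)   ≡⟨ cong (λ w → ((x + two * y) * w) ^ (2 ℕ.^ r′)) (*-identityʳ _) ⟩
    ((x + two * y) * (x + two * y)) ^ (2 ℕ.^ r′)
      ≡⟨ cong (_^ (2 ℕ.^ r′)) (trans (square-+2* x y) (cong (x *_) (sym (*-identityʳ x)))) ⟩
    (x ^ 2) ^ (2 ℕ.^ r′)               ≡⟨ ^-assocʳ x 2 (2 ℕ.^ r′) ⟩
    x ^ (2 ℕ.* 2 ℕ.^ r′)               ∎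

  Teichmüller : Carrier → Set
  Teichmüller t = t ^ q ≡ t

  Teichmüller-0 : Teichmüller 0#
  Teichmüller-0 = 0^2^ r

  Teichmüller-* : ∀ {s t} → Teichmüller s → Teichmüller t → Teichmüller (s * t)
  Teichmüller-* {s} {t} s^q≡s t^q≡t = trans (^-distrib-* s t q) (cong₂ _*_ s^q≡s t^q≡t)

  Teichmüller-^2^ : ∀ {t} k → Teichmüller t → Teichmüller (t ^2^ k)
  Teichmüller-^2^ {t} k t^q≡t = trans (^2^-comm t k r) (cong (_^2^ k) t^q≡t)

  IsTeich⇒Teichmüller : ∀ {t} → IsTeich t → Teichmüller t
  IsTeich⇒Teichmüller (inj₁ refl) = Teichmüller-0
  IsTeich⇒Teichmüller {t} (inj₂ t^[q∸1]≡1) = begin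
    t ^ q              ≡⟨ cong (t ^_) q≡1+[q∸1] ⟩
    t * t ^ (q ∸ 1)    ≡⟨ cong (t *_) (trans (sym (pow≡^ t (q ∸ 1))) t^[q∸1]≡1) ⟩
    t * 1#             ≡⟨ *-identityʳ t ⟩
    t                  ∎

  two^q≡0 : two ^ q ≡ 0#
  two^q≡0 = begin
    two ^ (2 ℕ.* 2 ℕ.^ r′)       ≡⟨ sym (^-assocʳ two 2 (2 ℕ.^ r′)) ⟩
    (two ^ 2) ^ (2 ℕ.^ r′)       ≡⟨ cong (λ w → (two * w) ^ (2 ℕ.^ r′)) (*-identityʳ two) ⟩
    (two * two) ^ (2 ℕ.^ r′)     ≡⟨ cong (_^2^ r′) two*two≡0 ⟩
    0# ^2^ r′                    ≡⟨ 0^2^ r′ ⟩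
    0#                           ∎

  Teichmüller⇒IsTeich : ∀ {t} → Teichmüller t → IsTeich t
  Teichmüller⇒IsTeich {t} t^q≡t with Enum._≟_ F.card (π t) F.0#
  ... | yes πt≡0 with π-ker t πt≡0
  ...   | y , t≡2y = inj₁ (begin
    t                  ≡⟨ sym t^q≡t ⟩
    t ^ q              ≡⟨ cong (_^ q) t≡2y ⟩
    (two * y) ^ q      ≡⟨ ^-distrib-* two y q ⟩
    two ^ q * y ^ q    ≡⟨ cong (_* y ^ q) two^q≡0 ⟩
    0# * y ^ q         ≡⟨ zeroˡ _ ⟩
    0#                 ∎)
  Teichmüller⇒IsTeich {t} t^q≡t | no πt≢0 with local t πt≢0
  ... | w , tw≡1 = inj₂ (begin
    pow t (q ∸ 1)                ≡⟨ pow≡^ t (q ∸ 1) ⟩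
    t ^ (q ∸ 1)                  ≡⟨ sym (*-identityʳ _) ⟩
    t ^ (q ∸ 1) * 1#             ≡⟨ cong (t ^ (q ∸ 1) *_) (sym tw≡1) ⟩
    t ^ (q ∸ 1) * (t * w)        ≡⟨ solve 3 (λ a t w → a :* (t :* w) := (t :* a) :* w) refl _ t w ⟩
    t ^ suc (q ∸ 1) * w          ≡⟨ cong (λ n → t ^ n * w) (sym q≡1+[q∸1]) ⟩
    t ^ q * w                    ≡⟨ cong (_* w) t^q≡t ⟩
    t * w                        ≡⟨ tw≡1 ⟩
    1#                           ∎)

  Teichmüller-unique : ∀ {s t} → Teichmüller s → Teichmüller t → π s ≡ π t → s ≡ t
  Teichmüller-unique {s} {t} s^q≡s t^q≡t πs≡πt with π-difference πs≡πt
  ... | w , s≡t+2w = trans (sym s^q≡s) (trans (cong (_^ q) s≡t+2w) (trans (^q-+2* t w) t^q≡t))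

  -- x^q is the Teichmüller representative of π x
  Teichmüller-exists : ∀ u → ∃ λ t → Teichmüller t × π t ≡ u
  Teichmüller-exists u with π-surj u
  ... | x , πx≡u = x ^ q , Teichmüller-x^q , π[x^q]≡u
    where
    π[x^q]≡u : π (x ^ q) ≡ u
    π[x^q]≡u = trans (π-^ x q) (trans (cong (Fᴾ._^ q) πx≡u) (x^q≡xᶠ u))
    Teichmüller-x^q : Teichmüller (x ^ q)
    Teichmüller-x^q with π-difference (trans π[x^q]≡u (sym πx≡u))
    ... | w , x^q≡x+2w = trans (cong (_^ q) x^q≡x+2w) (^q-+2* x w)

  private
    lift-spec : ∀ u → IsTeich (lift u) × π (lift u) ≡ u
    lift-spec u = let (t , t^q≡t , πt≡u) = Teichmüller-exists u in
      firstOr-satisfies {P = λ t → IsTeich t × π t ≡ u} _ 0# (∈-elems card t) (Teichmüller⇒IsTeich t^q≡t , πt≡u)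

  lift-Teichmüller : ∀ u → Teichmüller (lift u)
  lift-Teichmüller u = IsTeich⇒Teichmüller (proj₁ (lift-spec u))

  π-lift : ∀ u → π (lift u) ≡ u
  π-lift u = proj₂ (lift-spec u)

  lift-unique : ∀ {t u} → Teichmüller t → π t ≡ u → lift u ≡ t
  lift-unique t^q≡t πt≡u = Teichmüller-unique (lift-Teichmüller _) t^q≡t (trans (π-lift _) (sym πt≡u))

  lift-^2^ : ∀ u k → lift (u Fᴾ.^2^ k) ≡ lift u ^2^ k
  lift-^2^ u k = lift-unique (Teichmüller-^2^ k (lift-Teichmüller u)) (trans (π-^2^ _ k) (cong (Fᴾ._^2^ k) (π-lift u)))

  Decomposition : Carrier → Carrier → Carrier → Set
  Decomposition x a b = Teichmüller a × Teichmüller b × x ≡ a + two * b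

  decomposition-unique : ∀ {x a b a′ b′} → Decomposition x a b → Decomposition x a′ b′ → a ≡ a′ × b ≡ b′
  decomposition-unique {x} {a} {b} {a′} {b′} (a^q≡a , b^q≡b , x≡a+2b) (a′^q≡a′ , b′^q≡b′ , x≡a′+2b′) =
    a≡a′ , b≡b′
    where
    a≡a′ : a ≡ a′
    a≡a′ = Teichmüller-unique a^q≡a a′^q≡a′
      (trans (sym (π-+2* a b)) (trans (cong π (trans (sym x≡a+2b) x≡a′+2b′)) (π-+2* a′ b′)))
    b≡b′ : b ≡ b′
    b≡b′ = Teichmüller-unique b^q≡b b′^q≡b′ (two*-injective-π (+-cancelˡ a _ _
      (trans (sym x≡a+2b) (trans x≡a′+2b′ (cong (_+ two * b′) (sym a≡a′))))))

  teich-decomposition : ∀ x → Decomposition x (teichA x) (teichB x)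
  teich-decomposition x = lift-Teichmüller (π x) , IsTeich⇒Teichmüller (proj₁ teichB-spec) , proj₂ teichB-spec
    where
    w = proj₁ (π-difference (sym (π-lift (π x))))
    x≡a+2t : x ≡ teichA x + two * lift (π w)
    x≡a+2t = trans (proj₂ (π-difference (sym (π-lift (π x))))) (cong (teichA x +_) (two*-cong-π (sym (π-lift (π w)))))
    teichB-spec : IsTeich (teichB x) × x ≡ teichA x + two * teichB x
    teichB-spec = firstOr-satisfies {P = λ t → IsTeich t × x ≡ teichA x + two * t} _ 0# (∈-elems card _)
      (Teichmüller⇒IsTeich (lift-Teichmüller (π w)) , x≡a+2t)

  +2*-shift : ∀ {a m u} → a + two * m ≡ u → a ≡ u + two * m
  +2*-shift {a} {m} {u} a+2m≡u = begin
    a                          ≡⟨ sym (+-identityʳ a) ⟩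
    a + 0#                     ≡⟨ cong (a +_) (sym (two*x+two*x≡0 m)) ⟩
    a + (two * m + two * m)    ≡⟨ sym (+-assoc a _ _) ⟩
    (a + two * m) + two * m    ≡⟨ cong (_+ two * m) a+2m≡u ⟩
    u + two * m                ∎

  private
    square-+ : ∀ x y → (x * x + y * y) + two * (x * y) ≡ (x + y) * (x + y)
    square-+ x y = trans (cong (x * x + y * y +_) (two*≡+ (x * y)))
      (solve 2 (λ x y → (x :* x :+ y :* y) :+ (x :* y :+ x :* y) := (x :+ y) :* (x :+ y)) refl x y)

  -- With a = a′², c = c′² the carry of a + c is m = a′c′, and u is the Teichmüller part of (a′ + c′)².
  teichmüller-carry : ∀ {a c} → Teichmüller a → Teichmüller c → ∃ λ u → ∃ λ m →
    Teichmüller u × (a + c ≡ u + two * m) × (a * a + c * c ≡ u * u + two * (m * m))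
  teichmüller-carry {a} {c} a^q≡a c^q≡c = u , m , Teichmüller-* s₀^q≡s₀ s₀^q≡s₀ , a+c≡u+2m , a²+c²≡u²+2m²
    where
    √ : Carrier → Carrier
    √ t = t ^2^ r′
    √-square : ∀ {t} → Teichmüller t → √ t * √ t ≡ t
    √-square {t} t^q≡t = trans (sym (^2^-suc t r′)) t^q≡t
    s₀ = teichA (√ a + √ c)
    s₀^q≡s₀ = proj₁ (teich-decomposition (√ a + √ c))
    u = s₀ * s₀
    m = √ a * √ c
    a+c≡u+2m : a + c ≡ u + two * m
    a+c≡u+2m = +2*-shift (begin
      (a + c) + two * m
        ≡⟨ cong₂ (λ x y → (x + y) + two * m) (sym (√-square a^q≡a)) (sym (√-square c^q≡c)) ⟩
      (√ a * √ a + √ c * √ c) + two * m         ≡⟨ square-+ (√ a) (√ c) ⟩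
      (√ a + √ c) * (√ a + √ c)
        ≡⟨ cong (λ w → w * w) (proj₂ (proj₂ (teich-decomposition (√ a + √ c)))) ⟩
      (s₀ + two * _) * (s₀ + two * _)           ≡⟨ square-+2* s₀ _ ⟩
      u                                         ∎)
    a²+c²≡u²+2m² : a * a + c * c ≡ u * u + two * (m * m)
    a²+c²≡u²+2m² = +2*-shift (begin
      (a * a + c * c) + two * (m * m)  ≡⟨ cong (λ w → (a * a + c * c) + two * w) m²≡ac ⟩
      (a * a + c * c) + two * (a * c)  ≡⟨ square-+ a c ⟩
      (a + c) * (a + c)                ≡⟨ cong (λ w → w * w) a+c≡u+2m ⟩
      (u + two * m) * (u + two * m)    ≡⟨ square-+2* u m ⟩
      u * u                            ∎)
      where
      m²≡ac : m * m ≡ a * c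
      m²≡ac = trans (solve 2 (λ x y → (x :* y) :* (x :* y) := (x :* x) :* (y :* y)) refl (√ a) (√ c))
                    (cong₂ _*_ (√-square a^q≡a) (√-square c^q≡c))

  two*-square-+₃ : ∀ m b d → two * ((m + b + d) * (m + b + d)) ≡ two * (m * m + b * b + d * d)
  two*-square-+₃ m b d = begin
    two * ((m + b + d) * (m + b + d))
      ≡⟨ cong (two *_) (solve 3 (λ m b d → (m :+ b :+ d) :* (m :+ b :+ d) :=
            (m :* m :+ b :* b :+ d :* d) :+ ((m :* b :+ m :* d :+ b :* d) :+ (m :* b :+ m :* d :+ b :* d))) refl m b d) ⟩
    two * ((m * m + b * b + d * d) + (X + X))          ≡⟨ distribˡ two _ _ ⟩
    two * (m * m + b * b + d * d) + two * (X + X)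
      ≡⟨ cong (two * (m * m + b * b + d * d) +_) (trans (distribˡ two X X) (two*x+two*x≡0 X)) ⟩
    two * (m * m + b * b + d * d) + 0#                 ≡⟨ +-identityʳ _ ⟩
    two * (m * m + b * b + d * d)                      ∎
    where
    X = m * b + m * d + b * d

  frobenius-additive : ∀ {x y a b c d e f} → Decomposition x a b → Decomposition y c d → Decomposition (x + y) e f →
    (a * a + two * (b * b)) + (c * c + two * (d * d)) ≡ e * e + two * (f * f)
  frobenius-additive {x} {y} {a} {b} {c} {d} {e} {f} (a^q≡a , _ , x≡a+2b) (c^q≡c , _ , y≡c+2d) x+y≡e+2f = begin
    (a * a + two * (b * b)) + (c * c + two * (d * d))
      ≡⟨ solve 5 (λ A B C D t → (A :+ t :* B) :+ (C :+ t :* D) := (A :+ C) :+ (t :* B :+ t :* D))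
                 refl (a * a) (b * b) (c * c) (d * d) two ⟩
    (a * a + c * c) + (two * (b * b) + two * (d * d))        ≡⟨ cong (_+ (two * (b * b) + two * (d * d))) a²+c²≡u²+2m² ⟩
    (u * u + two * (m * m)) + (two * (b * b) + two * (d * d))
      ≡⟨ solve 5 (λ U M B D t → (U :+ t :* M) :+ (t :* B :+ t :* D) := U :+ t :* (M :+ B :+ D))
                 refl (u * u) (m * m) (b * b) (d * d) two ⟩
    u * u + two * (m * m + b * b + d * d)                    ≡⟨ cong (u * u +_) (sym (two*-square-+₃ m b d)) ⟩
    u * u + two * ((m + b + d) * (m + b + d))                ≡⟨ cong (u * u +_) (sym 2g²≡2[m+b+d]²) ⟩
    u * u + two * (g * g)
      ≡⟨ cong₂ (λ s t → s * s + two * (t * t)) (sym (proj₁ e≡u×f≡g)) (sym (proj₂ e≡u×f≡g)) ⟩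
    e * e + two * (f * f)                                    ∎
    where
    carry = teichmüller-carry a^q≡a c^q≡c
    u = proj₁ carry
    m = proj₁ (proj₂ carry)
    u^q≡u = proj₁ (proj₂ (proj₂ carry))
    a+c≡u+2m = proj₁ (proj₂ (proj₂ (proj₂ carry)))
    a²+c²≡u²+2m² = proj₂ (proj₂ (proj₂ (proj₂ carry)))
    g = lift (π (m + b + d))
    2g≡2[m+b+d] : two * g ≡ two * (m + b + d)
    2g≡2[m+b+d] = two*-cong-π (π-lift _)
    2g²≡2[m+b+d]² : two * (g * g) ≡ two * ((m + b + d) * (m + b + d))
    2g²≡2[m+b+d]² = two*-cong-π (trans (π-* g g) (trans (cong₂ F._*_ (π-lift _) (π-lift _)) (sym (π-* _ _))))
    x+y≡u+2g : x + y ≡ u + two * g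
    x+y≡u+2g = begin
      x + y                                 ≡⟨ cong₂ _+_ x≡a+2b y≡c+2d ⟩
      (a + two * b) + (c + two * d)
        ≡⟨ solve 5 (λ a b c d t → (a :+ t :* b) :+ (c :+ t :* d) := (a :+ c) :+ (t :* b :+ t :* d)) refl a b c d two ⟩
      (a + c) + (two * b + two * d)         ≡⟨ cong (_+ (two * b + two * d)) a+c≡u+2m ⟩
      (u + two * m) + (two * b + two * d)
        ≡⟨ solve 5 (λ u m b d t → (u :+ t :* m) :+ (t :* b :+ t :* d) := u :+ t :* (m :+ b :+ d)) refl u m b d two ⟩
      u + two * (m + b + d)                 ≡⟨ cong (u +_) (sym 2g≡2[m+b+d]) ⟩
      u + two * g                           ∎
    e≡u×f≡g : e ≡ u × f ≡ g
    e≡u×f≡g = decomposition-unique x+y≡e+2f (u^q≡u , lift-Teichmüller _ , x+y≡u+2g)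

  -- On x = a + 2b the k-th power of the Frobenius automorphism of R is a^(2^k) + 2 b^(2^k).
  frobenius : ℕ → Carrier → Carrier → Carrier
  frobenius k a b = a ^2^ k + two * b ^2^ k

  frobenius-decomposition : ∀ k {x a b} → Decomposition x a b → Decomposition (frobenius k a b) (a ^2^ k) (b ^2^ k)
  frobenius-decomposition k (a^q≡a , b^q≡b , _) = Teichmüller-^2^ k a^q≡a , Teichmüller-^2^ k b^q≡b , refl

  frobenius-+ : ∀ k {x y a b c d e f} → Decomposition x a b → Decomposition y c d → Decomposition (x + y) e f →
                frobenius k a b + frobenius k c d ≡ frobenius k e f
  frobenius-+ zero {a = a} {b} {c} {d} {e} {f} (_ , _ , x≡a+2b) (_ , _ , y≡c+2d) (_ , _ , x+y≡e+2f) = begin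
    frobenius 0 a b + frobenius 0 c d  ≡⟨ cong₂ _+_ (frobenius-zero a b) (frobenius-zero c d) ⟩
    (a + two * b) + (c + two * d)      ≡⟨ sym (cong₂ _+_ x≡a+2b y≡c+2d) ⟩
    _ + _                              ≡⟨ x+y≡e+2f ⟩
    e + two * f                        ≡⟨ sym (frobenius-zero e f) ⟩
    frobenius 0 e f                    ∎
    where
    frobenius-zero : ∀ a b → frobenius 0 a b ≡ a + two * b
    frobenius-zero a b = cong₂ (λ s t → s + two * t) (^2^-zero a) (^2^-zero b)
  frobenius-+ (suc k) {a = a} {b} {c} {d} {e} {f} x≡a+2b y≡c+2d x+y≡e+2f = begin
    frobenius (suc k) a b + frobenius (suc k) c d
      ≡⟨ cong₂ _+_ (frobenius-suc a b) (frobenius-suc c d) ⟩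
    (a ^2^ k * a ^2^ k + two * (b ^2^ k * b ^2^ k)) + (c ^2^ k * c ^2^ k + two * (d ^2^ k * d ^2^ k))
      ≡⟨ frobenius-additive (frobenius-decomposition k x≡a+2b) (frobenius-decomposition k y≡c+2d)
           (subst (λ z → Decomposition z (e ^2^ k) (f ^2^ k)) (sym (frobenius-+ k x≡a+2b y≡c+2d x+y≡e+2f))
                  (frobenius-decomposition k x+y≡e+2f)) ⟩
    e ^2^ k * e ^2^ k + two * (f ^2^ k * f ^2^ k)
      ≡⟨ sym (frobenius-suc e f) ⟩
    frobenius (suc k) e f ∎
    where
    frobenius-suc : ∀ a b → frobenius (suc k) a b ≡ a ^2^ k * a ^2^ k + two * (b ^2^ k * b ^2^ k)
    frobenius-suc a b = cong₂ (λ s t → s + two * t) (^2^-suc a k) (^2^-suc b k)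

  Tr≡∑ : ∀ x → Tr x ≡ ∑ r (λ k → frobenius k (teichA x) (teichB x))
  Tr≡∑ x = sumFin≡∑ r {g = λ k → frobenius k (teichA x) (teichB x)}
    (λ k → cong₂ (λ s t → s + two * t) (pow≡^ (teichA x) (2 ℕ.^ toℕ k)) (pow≡^ (teichB x) (2 ℕ.^ toℕ k)))

  Tr-distrib-+ : ∀ x y → Tr (x + y) ≡ Tr x + Tr y
  Tr-distrib-+ x y = begin
    Tr (x + y)                                   ≡⟨ Tr≡∑ (x + y) ⟩
    ∑ r (λ k → frobenius k (teichA (x + y)) (teichB (x + y)))
      ≡⟨ ∑-cong-≗ r (λ k → sym (frobenius-+ k (teich-decomposition x) (teich-decomposition y)
                                             (teich-decomposition (x + y)))) ⟩
    ∑ r (λ k → σ x k + σ y k)                    ≡⟨ ∑-distrib-+ r (σ x) (σ y) ⟩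
    ∑ r (σ x) + ∑ r (σ y)                        ≡⟨ sym (cong₂ _+_ (Tr≡∑ x) (Tr≡∑ y)) ⟩
    Tr x + Tr y                                  ∎
    where
    σ : Carrier → ℕ → Carrier
    σ z k = frobenius k (teichA z) (teichB z)

  Tr-0 : Tr 0# ≡ 0#
  Tr-0 = +-cancelˡ (Tr 0#) _ _ (trans (sym (Tr-distrib-+ 0# 0#)) (trans (cong Tr (+-identityʳ 0#)) (sym (+-identityʳ _))))

  Tr-∑ : ∀ n f → Tr (∑ n f) ≡ ∑ n (Tr ∘ f)
  Tr-∑ zero    f = Tr-0
  Tr-∑ (suc n) f = trans (Tr-distrib-+ _ _) (cong (Tr (f 0) +_) (Tr-∑ n (f ∘ suc)))

  Tr-Teichmüller : ∀ {t} → Teichmüller t → Tr t ≡ ∑ r (t ^2^_)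
  Tr-Teichmüller {t} t^q≡t = trans (Tr≡∑ t) (∑-cong-≗ r λ k → begin
    teichA t ^2^ k + two * teichB t ^2^ k
      ≡⟨ cong₂ (λ s w → s ^2^ k + two * w ^2^ k) (proj₁ a≡t×b≡0) (proj₂ a≡t×b≡0) ⟩
    t ^2^ k + two * 0# ^2^ k                ≡⟨ cong (λ w → t ^2^ k + two * w) (0^2^ k) ⟩
    t ^2^ k + two * 0#                      ≡⟨ trans (cong (t ^2^ k +_) (zeroʳ two)) (+-identityʳ _) ⟩
    t ^2^ k                                 ∎)
    where
    a≡t×b≡0 : teichA t ≡ t × teichB t ≡ 0#
    a≡t×b≡0 = decomposition-unique (teich-decomposition t)
      (t^q≡t , Teichmüller-0 , sym (trans (cong (t +_) (zeroʳ two)) (+-identityʳ t)))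

module SymplecticMultiplication {r′ : ℕ} {F : FiniteField (suc r′)} (R : GaloisRing4 (suc r′) F)
                              (a : Fin (suc r′) → Fin (suc r′) → FiniteField.Carrier F) where
  open GaloisRing4 R using (lift; Tr; ring; _*_)
  module F = FiniteField F
  open GaloisRingProperties R
  module Rᴾ = CRingProperties ring
  module Formsᶠ = FrobeniusForms F.ring r
  module Formsᴿ = FrobeniusForms ring r
  open FiniteFieldProperties F using () renaming (x^q≡x to x^q≡xᶠ)
  open BinaryFieldProperties F two≡0ᶠ using (tr≡∑; frobForm-injective; symplectic⇒tr-symmetric)
  open Characteristic2 F.ring two≡0ᶠ using (^2^-distrib-∑)
  open ≡-Reasoning

  index : ℕ → Fin r
  index i = Fin.fromℕ< (m%n<n i r)

  index-toℕ : ∀ i → index (toℕ i) ≡ i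
  index-toℕ i = trans (Fin.fromℕ<-cong _ _ (m<n⇒m%n≡m (Fin.toℕ<n i)) _ (Fin.toℕ<n i))
                      (Fin.fromℕ<-toℕ i (Fin.toℕ<n i))

  index-periodic : ∀ i → index (i ℕ.+ r) ≡ index i
  index-periodic i = Fin.fromℕ<-cong _ _ ([m+n]%n≡m%n i r) _ _

  A : ℕ → ℕ → F.Carrier
  A i j = a (index i) (index j)

  a≡A : ∀ i j → a i j ≡ A (toℕ i) (toℕ j)
  a≡A i j = sym (cong₂ a (index-toℕ i) (index-toℕ j))

  A-periodic : Formsᶠ.Periodic₂ A
  A-periodic = (λ j i → cong (λ i → a i (index j)) (index-periodic i)) , (λ i j → cong (a (index i)) (index-periodic j))

  lift∘A-periodic : Formsᴿ.Periodic₂ (λ i j → lift (A i j))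
  lift∘A-periodic = (λ j i → cong lift (proj₁ A-periodic j i)) , (λ i j → cong lift (proj₂ A-periodic i j))

  tr-expand : ∀ x z y → F.tr (x F.* circ F a z y) ≡ Formsᶠ.frobForm (Formsᶠ.twist A) x z y
  tr-expand x z y = begin
    F.tr (x F.* circ F a z y)
      ≡⟨ tr≡∑ _ ⟩
    Fᴾ.∑ r (λ k → (x F.* circ F a z y) Fᴾ.^2^ k)
      ≡⟨ Fᴾ.∑-cong-≗ r (λ k → begin
           (x F.* circ F a z y) Fᴾ.^2^ k
             ≡⟨ cong (Fᴾ._^2^ k) (Formsᶠ.*-sumFin²≡∑² a A a≡A x z y) ⟩
           Fᴾ.∑ r (λ i → Fᴾ.∑ r (term i)) Fᴾ.^2^ k
             ≡⟨ trans (^2^-distrib-∑ r (λ i → Fᴾ.∑ r (term i)) k)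
                      (Fᴾ.∑-cong-≗ r (λ i → ^2^-distrib-∑ r (term i) k)) ⟩
           Fᴾ.∑ r (λ i → Fᴾ.∑ r (λ j → term i j Fᴾ.^2^ k)) ∎) ⟩
    Fᴾ.∑ r (λ k → Fᴾ.∑ r (λ i → Fᴾ.∑ r (λ j → term i j Fᴾ.^2^ k)))
      ≡⟨ Formsᶠ.∑-frobenius-expand A A-periodic x z y (x^q≡xᶠ z) (x^q≡xᶠ y) ⟩
    Formsᶠ.frobForm (Formsᶠ.twist A) x z y ∎
    where
    term : ℕ → ℕ → F.Carrier
    term i j = x F.* (A i j F.* z Fᴾ.^2^ i F.* y Fᴾ.^2^ j)

  twist-symmetric : IsSymplectic F a →
                    ∀ k m n → k < r → m < r → n < r → Formsᶠ.twist A k m n ≡ Formsᶠ.twist A m k n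
  twist-symmetric symplectic = frobForm-injective (Formsᶠ.twist A) (λ k m n → Formsᶠ.twist A m k n) λ x z y → begin
    Formsᶠ.frobForm (Formsᶠ.twist A) x z y                       ≡⟨ sym (tr-expand x z y) ⟩
    F.tr (x F.* circ F a z y)                            ≡⟨ symplectic⇒tr-symmetric a symplectic x y z ⟩
    F.tr (z F.* circ F a x y)                            ≡⟨ tr-expand z x y ⟩
    Formsᶠ.frobForm (Formsᶠ.twist A) z x y                       ≡⟨ Formsᶠ.frobForm-swap (Formsᶠ.twist A) x z y ⟩
    Formsᶠ.frobForm (λ k m n → Formsᶠ.twist A m k n) x z y       ∎

  Tr-expand : ∀ {X Z Y} → Teichmüller X → Teichmüller Z → Teichmüller Y →
              Tr (X * circR F a R Z Y) ≡ Formsᴿ.frobForm (Formsᴿ.twist (λ i j → lift (A i j))) X Z Y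
  Tr-expand {X} {Z} {Y} X^q≡X Z^q≡Z Y^q≡Y = begin
    Tr (X * circR F a R Z Y)
      ≡⟨ cong Tr (Formsᴿ.*-sumFin²≡∑² (λ i j → lift (a i j)) (λ i j → lift (A i j))
                                       (λ i j → cong lift (a≡A i j)) X Z Y) ⟩
    Tr (Rᴾ.∑ r (λ i → Rᴾ.∑ r (term i)))
      ≡⟨ trans (Tr-∑ r (λ i → Rᴾ.∑ r (term i))) (Rᴾ.∑-cong-≗ r (λ i → Tr-∑ r (term i))) ⟩
    Rᴾ.∑ r (λ i → Rᴾ.∑ r (λ j → Tr (term i j)))
      ≡⟨ Rᴾ.∑-cong-≗ r (λ i → Rᴾ.∑-cong-≗ r (λ j → Tr-Teichmüller (term-Teichmüller i j))) ⟩
    Rᴾ.∑ r (λ i → Rᴾ.∑ r (λ j → Rᴾ.∑ r (λ k → term i j Rᴾ.^2^ k)))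
      ≡⟨ trans (Rᴾ.∑-cong-≗ r (λ i → Rᴾ.∑-comm r r (λ j k → term i j Rᴾ.^2^ k)))
               (Rᴾ.∑-comm r r (λ i k → Rᴾ.∑ r (λ j → term i j Rᴾ.^2^ k))) ⟩
    Rᴾ.∑ r (λ k → Rᴾ.∑ r (λ i → Rᴾ.∑ r (λ j → term i j Rᴾ.^2^ k)))
      ≡⟨ Formsᴿ.∑-frobenius-expand (λ i j → lift (A i j)) lift∘A-periodic X Z Y Z^q≡Z Y^q≡Y ⟩
    Formsᴿ.frobForm (Formsᴿ.twist (λ i j → lift (A i j))) X Z Y ∎
    where
    term : ℕ → ℕ → GaloisRing4.Carrier R
    term i j = X * (lift (A i j) * Z Rᴾ.^2^ i * Y Rᴾ.^2^ j)
    term-Teichmüller : ∀ i j → Teichmüller (term i j)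
    term-Teichmüller i j = Teichmüller-* X^q≡X
      (Teichmüller-* (Teichmüller-* (lift-Teichmüller _) (Teichmüller-^2^ i Z^q≡Z)) (Teichmüller-^2^ j Y^q≡Y))

  Tr-symmetric : IsSymplectic F a → ∀ x y z →
    Tr (lift x * circR F a R (lift z) (lift y)) ≡ Tr (lift z * circR F a R (lift x) (lift y))
  Tr-symmetric symplectic x y z = begin
    Tr (X * circR F a R Z Y)                  ≡⟨ Tr-expand X^q≡X Z^q≡Z Y^q≡Y ⟩
    Formsᴿ.frobForm c X Z Y                       ≡⟨ Formsᴿ.frobForm-cong c-symmetric X Z Y ⟩
    Formsᴿ.frobForm (λ k m n → c m k n) X Z Y     ≡⟨ sym (Formsᴿ.frobForm-swap c X Z Y) ⟩
    Formsᴿ.frobForm c Z X Y                       ≡⟨ sym (Tr-expand Z^q≡Z X^q≡X Y^q≡Y) ⟩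
    Tr (Z * circR F a R X Y)                  ∎
    where
    X = lift x
    Y = lift y
    Z = lift z
    X^q≡X = lift-Teichmüller x
    Y^q≡Y = lift-Teichmüller y
    Z^q≡Z = lift-Teichmüller z
    c = Formsᴿ.twist (λ i j → lift (A i j))
    lift-twist : ∀ k m n → c k m n ≡ lift (Formsᶠ.twist A k m n)
    lift-twist k m n = sym (lift-^2^ _ k)
    c-symmetric : ∀ k m n → k < r → m < r → n < r → c k m n ≡ c m k n
    c-symmetric k m n k<r m<r n<r =
      trans (lift-twist k m n) (trans (cong lift (twist-symmetric symplectic k m n k<r m<r n<r)) (sym (lift-twist m k n)))

¬FiniteField-0 : ¬ FiniteField 0
¬FiniteField-0 F = nontrivial (begin
  1#                 ≡⟨ sym (strictlyInverseˡ 1#) ⟩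
  to (from 1#)       ≡⟨ cong to (Fin-1-unique (from 1#) (from 0#)) ⟩
  to (from 0#)       ≡⟨ strictlyInverseˡ 0# ⟩
  0#                 ∎)
  where
  open FiniteField F
  open Inverse card
  open ≡-Reasoning
  Fin-1-unique : (i j : Fin 1) → i ≡ j
  Fin-1-unique Fin.zero Fin.zero = refl

lemma4p1 : (r : ℕ) (F : FiniteField r) (R : GaloisRing4 r F)
           (a : Fin r → Fin r → FiniteField.Carrier F) →
           IsPresemifield F a → IsSymplectic F a →
           (∀ x y z →
              FiniteField.tr F (FiniteField._*_ F x (circ F a z y))
                ≡ FiniteField.tr F (FiniteField._*_ F z (circ F a x y)))
           ×
           (∀ x y z →
              GaloisRing4.Tr R (GaloisRing4._*_ R (GaloisRing4.lift R x)
                                  (circR F a R (GaloisRing4.lift R z) (GaloisRing4.lift R y)))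
                ≡ GaloisRing4.Tr R (GaloisRing4._*_ R (GaloisRing4.lift R z)
                                  (circR F a R (GaloisRing4.lift R x) (GaloisRing4.lift R y))))
lemma4p1 zero     F R a _ _          = ⊥-elim (¬FiniteField-0 F)
lemma4p1 (suc r′) F R a _ symplectic =
    BinaryFieldProperties.symplectic⇒tr-symmetric F (GaloisRingProperties.two≡0ᶠ R) a symplectic
  , SymplecticMultiplication.Tr-symmetric R a symplectic
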